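{- Let $k$ be a positive integer, $T$ a tournament and $A,S \subseteq V(T)$ with $|S| \geq 2^{30k}$. Suppose that every vertex $v \in S$ has at least $|A|/20$ out-neighbors (resp. in-neighbors) in $A$. Then $S$ contains an $A$-head (resp. $A$-tail) of size $k$. Moreover, any set of at least $2^{30k}$ vertices of $T$, each of which has at least $|A|/20$ out-neighbors (resp. in-neighbors) in $A$, is such that at least a $1/2^{30k^2}$ fraction of its $k$-element subsets are $A$-heads (resp. $A$-tails).
   Context: A tournament is an orientation of a complete graph. For a tournament $T$ and $A,S\subseteq V(T)$ with $|S|=k$, $S$ is an $A$-head (resp. $A$-tail) if $T[S]$ is a transitive tournament and the set of common out-neighbors (resp. common in-neighbors) of $S$ in $A$, i.e. the vertices $a\in A$ with $s\to a$ (resp. $a\to s$) for all $s\in S$, has size at least $|A|/2^{6k}$. -}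

module Defs where

open import Data.Nat using (ℕ; zero; suc; _+_; _*_; _^_; _≤_; _≤ᵇ_; _≡ᵇ_)
open import Data.Bool using (Bool; true; false; not; _∧_; _∨_; T)
open import Data.Fin using (Fin) renaming (zero to fzero; suc to fsuc)
open import Data.Fin.Subset using (Subset; _∈_; _⊆_; ∣_∣)
open import Data.Vec using (Vec; []; _∷_; lookup; tabulate)
open import Data.List using (List; []; _∷_; map; _++_; length; filter)
import Data.List as List
open import Data.Product using (_×_)
open import Relation.Binary.PropositionalEquality using (_≡_; _≢_)
open import Relation.Nullary.Decidable using (Dec)

record Tournament (n : ℕ) : Set where
  field
    E       : Fin n → Fin n → Bool
    irrefl  : ∀ u → E u u ≡ false
    tourn   : ∀ u v → u ≢ v → E v u ≡ not (E u v)
open Tournament public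

allIn : ∀ {n} → Subset n → (Fin n → Bool) → Bool
allIn []          f = true
allIn (b ∷ S)     f = (not b ∨ f fzero) ∧ allIn S (λ i → f (fsuc i))

outIn : ∀ {n} → Tournament n → Fin n → Subset n → Subset n
outIn T v A = tabulate (λ a → lookup A a ∧ E T v a)

inIn : ∀ {n} → Tournament n → Fin n → Subset n → Subset n
inIn T v A = tabulate (λ a → lookup A a ∧ E T a v)

commonOut : ∀ {n} → Tournament n → Subset n → Subset n → Subset n
commonOut T S A = tabulate (λ a → lookup A a ∧ allIn S (λ s → E T s a))

commonIn : ∀ {n} → Tournament n → Subset n → Subset n → Subset n
commonIn T S A = tabulate (λ a → lookup A a ∧ allIn S (λ s → E T a s))

transitiveB : ∀ {n} → Tournament n → Subset n → Bool
transitiveB T S =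
  allIn S (λ x → allIn S (λ y → allIn S (λ z →
    not (E T x y ∧ E T y z) ∨ E T x z)))

-- S is an A-head of size k:  T[S] transitive, |S| = k,
-- and |common out-neighbours of S in A| ≥ |A| / 2^(6k), i.e. |A| ≤ 2^(6k) * |…|.
isHeadB : ∀ {n} → Tournament n → ℕ → Subset n → Subset n → Bool
isHeadB T k A S = transitiveB T S ∧ (∣ S ∣ ≡ᵇ k)
                  ∧ (∣ A ∣ ≤ᵇ (2 ^ (6 * k) * ∣ commonOut T S A ∣))

isTailB : ∀ {n} → Tournament n → ℕ → Subset n → Subset n → Bool
isTailB T k A S = transitiveB T S ∧ (∣ S ∣ ≡ᵇ k)
                  ∧ (∣ A ∣ ≤ᵇ (2 ^ (6 * k) * ∣ commonIn T S A ∣))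

IsHead : ∀ {n} → Tournament n → ℕ → Subset n → Subset n → Set
IsHead T k A S = Data.Bool.T (isHeadB T k A S)

IsTail : ∀ {n} → Tournament n → ℕ → Subset n → Subset n → Set
IsTail T k A S = Data.Bool.T (isTailB T k A S)

allSubsets : ∀ n → List (Subset n)
allSubsets zero    = [] ∷ []
allSubsets (suc n) = map (false ∷_) (allSubsets n) ++ map (true ∷_) (allSubsets n)

subB : ∀ {n} → Subset n → Subset n → Bool
subB S X = allIn S (λ s → lookup X s)

#heads : ∀ {n} → Tournament n → ℕ → Subset n → Subset n → ℕ
#heads {n} T k A X = List.length (List.filterᵇ (λ S → subB S X ∧ isHeadB T k A S) (allSubsets n))

#tails : ∀ {n} → Tournament n → ℕ → Subset n → Subset n → ℕ
#tails {n} T k A X = List.length (List.filterᵇ (λ S → subB S X ∧ isTailB T k A S) (allSubsets n))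

module Submission where

-- A greedy sequence v₁ … vₖ in X picks each vᵢ from X and from the out- or in-neighbourhood
-- (a side chosen for each j < i) of every earlier vⱼ; it therefore spans a transitive
-- subtournament, and a set of N vertices carries at least (N − 2ᵏ)ᵏ / 2^(k²) of them.
-- Dependent random choice: for t = 3k let Y be the set of vertices of X dominating all of
-- a₁ … aₜ ∈ A. Averaged over the |A|ᵗ tuples, |Y| ≥ |X| / 20ᵗ by the degree condition, so by
-- convexity of x ↦ xᵏ (the tangent-line inequality) Y carries many greedy sequences on average.
-- A sequence w is counted once for every tuple it dominates, i.e. d(w)ᵗ times, where d(w) is
-- the number of vertices of A dominated by all of w; sequences with d(w) < |A| / 2^(6k)
-- contribute at most |A|ᵗ / 2^(18k²) each. Hence many greedy sequences have d(w) ≥ |A| / 2^(6k):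
-- their vertex sets are A-heads, and each head arises from at most 2ᵏ kᵏ sequences.
-- Tails are the heads of the opposite tournament.

open import Defs
open import Data.Nat using (ℕ; _*_; _^_; _≤_)
open import Data.Nat.Combinatorics using (_C_; nCk+nC[k+1]≡[n+1]C[k+1])
open import Data.Fin.Subset using (Subset; _∈_; _⊆_; ∣_∣)
open import Data.Product using (_×_; ∃-syntax; _,_)

import Algebra.Properties.Semiring.Sum
open import Data.Bool as Bool using (Bool; true; false; not; _∧_; _∨_)
open import Data.Bool.Properties using (∧-assoc; ∧-comm; ∧-zeroʳ; ∧-identityʳ; ∨-zeroʳ; ∧-conicalˡ; ∧-conicalʳ; ⇔→≡; T-≡)
open import Data.Empty using (⊥-elim)
open import Data.Fin using (Fin) renaming (zero to fzero; suc to fsuc)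
import Data.Fin.Properties as Fin
open import Data.List using (List; []; _∷_; map; length; filterᵇ)
open import Data.List.Membership.Propositional renaming (_∈_ to _∈ˡ_)
open import Data.List.Membership.Propositional.Properties using (∈-map⁺; ∈-++⁺ˡ; ∈-++⁺ʳ)
open import Data.List.Relation.Unary.Any using (here; there)
open import Data.Nat
  using (zero; suc; _+_; _∸_; _<_; z≤n; s≤s; _≤ᵇ_; _≡ᵇ_; NonZero; >-nonZero; _/_; _%_)
open import Data.Nat.DivMod using (m≡m%n+[m/n]*n; m%n<n; m/n*n≤m; m*n/n≡m; /-monoˡ-≤)
open import Data.Nat.Properties
open import Data.Nat.Tactic.RingSolver using (solve-∀)
open import Data.Sum using (_⊎_; inj₁; inj₂)
open import Function.Bundles using (mk⇔; Equivalence)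
open import Data.Vec using ([]; _∷_; lookup; tabulate)
open import Data.Vec.Properties using (lookup∘tabulate; lookup⇒[]=; []=⇒lookup)
open import Function using (_∘_; flip; case_of_)
open import Relation.Binary.Definitions using (Asymmetric)
open import Relation.Binary.PropositionalEquality
open import Relation.Nullary using (¬_; does; yes; no)
open import Relation.Nullary.Decidable using (dec-true)

open Algebra.Properties.Semiring.Sum +-*-semiring
  using (sum; sum-syntax; sum-cong-≗; ∑-distrib-+; *-distribˡ-sum; *-distribʳ-sum; sum-replicate-zero)
open import Algebra.Properties.CommutativeSemigroup *-commutativeSemigroup using (x∙yz≈y∙xz)

𝟙 : Bool → ℕ
𝟙 true  = 1
𝟙 false = 0

𝟙≤1 : ∀ b → 𝟙 b ≤ 1
𝟙≤1 true  = ≤-refl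
𝟙≤1 false = z≤n

𝟙-∧ : ∀ a b → 𝟙 (a ∧ b) ≡ 𝟙 a * 𝟙 b
𝟙-∧ true  b = sym (+-identityʳ (𝟙 b))
𝟙-∧ false b = refl

𝟙-∧≤ˡ : ∀ a b → 𝟙 (a ∧ b) ≤ 𝟙 a
𝟙-∧≤ˡ true  b = 𝟙≤1 b
𝟙-∧≤ˡ false b = z≤n

𝟙-∧≤ʳ : ∀ a b → 𝟙 (a ∧ b) ≤ 𝟙 b
𝟙-∧≤ʳ true  b = ≤-refl
𝟙-∧≤ʳ false b = z≤n

𝟙*-mono : ∀ b {x y} → (b ≡ true → x ≤ y) → 𝟙 b * x ≤ 𝟙 b * y
𝟙*-mono true  x≤y = *-monoʳ-≤ 1 (x≤y refl)
𝟙*-mono false x≤y = z≤n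

sum-mono : ∀ {n} {f g : Fin n → ℕ} → (∀ i → f i ≤ g i) → sum f ≤ sum g
sum-mono {zero}  f≤g = z≤n
sum-mono {suc n} f≤g = +-mono-≤ (f≤g fzero) (sum-mono (f≤g ∘ fsuc))

∑-𝟙-≟ : ∀ {n} (v : Fin n) → ∑[ u < n ] 𝟙 (does (u Fin.≟ v)) ≡ 1
∑-𝟙-≟ {suc n} fzero    = cong suc (sum-replicate-zero n)
∑-𝟙-≟ {suc n} (fsuc v) = trans (sum-cong-≗ shift) (∑-𝟙-≟ v)
  where
  shift : ∀ u → 𝟙 (does (fsuc u Fin.≟ fsuc v)) ≡ 𝟙 (does (u Fin.≟ v))
  shift u with u Fin.≟ v
  ... | yes refl = refl
  ... | no _     = refl

∣∣≡∑𝟙 : ∀ {n} (S : Subset n) → ∣ S ∣ ≡ ∑[ i < n ] 𝟙 (lookup S i)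
∣∣≡∑𝟙 []          = refl
∣∣≡∑𝟙 (true  ∷ S) = cong suc (∣∣≡∑𝟙 S)
∣∣≡∑𝟙 (false ∷ S) = ∣∣≡∑𝟙 S

∣tabulate∣ : ∀ {n} (f : Fin n → Bool) → ∣ tabulate f ∣ ≡ ∑[ i < n ] 𝟙 (f i)
∣tabulate∣ f = trans (∣∣≡∑𝟙 (tabulate f)) (sum-cong-≗ (cong 𝟙 ∘ lookup∘tabulate f))

^-distribʳ-* : ∀ m n o → (m * n) ^ o ≡ m ^ o * n ^ o
^-distribʳ-* m n zero    = refl
^-distribʳ-* m n (suc o) = trans (cong (m * n *_) (^-distribʳ-* m n o)) (interchange m n (m ^ o) (n ^ o))
  where
  interchange : ∀ a b c d → a * b * (c * d) ≡ a * c * (b * d)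
  interchange = solve-∀

am-gm-shifted : ∀ s d → 2 * s * (s + d) ≤ (s + d) * (s + d) + s * s
am-gm-shifted s d = subst (2 * s * (s + d) ≤_) (square-gap s d) (m≤m+n (2 * s * (s + d)) (d * d))
  where
  square-gap : ∀ s d → 2 * s * (s + d) + d * d ≡ (s + d) * (s + d) + s * s
  square-gap = solve-∀

am-gm : ∀ s x → 2 * s * x ≤ x * x + s * s
am-gm s x with ≤-total s x
... | inj₁ s≤x = subst (λ y → 2 * s * y ≤ y * y + s * s) (m+[n∸m]≡n s≤x) (am-gm-shifted s (x ∸ s))
... | inj₂ x≤s = subst₂ _≤_ (swap x s) (+-comm (s * s) (x * x))
                   (subst (λ y → 2 * x * y ≤ y * y + x * x) (m+[n∸m]≡n x≤s) (am-gm-shifted x (s ∸ x)))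
  where
  swap : ∀ x s → 2 * x * s ≡ 2 * s * x
  swap = solve-∀

tangent-line : ∀ j x s → suc j * s ^ j * x ≤ x ^ suc j + j * s ^ suc j
tangent-line zero    x s = ≤-reflexive (base x)
  where
  base : ∀ x → 1 * 1 * x ≡ x * 1 + 0
  base = solve-∀
tangent-line (suc j) x s = +-cancelʳ-≤ (j * (s * P) * x) _ _ (begin
    suc (suc j) * (s * P) * x + j * (s * P) * x
  ≡⟨ split-coefficient j x s P ⟩
    suc j * P * (2 * s * x)
  ≤⟨ *-monoʳ-≤ (suc j * P) (am-gm s x) ⟩
    suc j * P * (x * x + s * s)
  ≡⟨ distribute j x s P ⟩
    suc j * P * x * x + suc j * (s * (s * P))
  ≤⟨ +-monoˡ-≤ _ (*-monoˡ-≤ x (tangent-line j x s)) ⟩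
    (x ^ suc j + j * (s * P)) * x + suc j * (s * (s * P))
  ≡⟨ collect j x s P (x ^ suc j) ⟩
    x * x ^ suc j + suc j * (s * (s * P)) + j * (s * P) * x
  ∎)
  where
  open ≤-Reasoning
  P = s ^ j
  split-coefficient : ∀ j x s P → suc (suc j) * (s * P) * x + j * (s * P) * x ≡ suc j * P * (2 * s * x)
  split-coefficient = solve-∀
  distribute : ∀ j x s P → suc j * P * (x * x + s * s) ≡ suc j * P * x * x + suc j * (s * (s * P))
  distribute = solve-∀
  collect : ∀ j x s P X → (X + j * (s * P)) * x + suc j * (s * (s * P))
                          ≡ x * X + suc j * (s * (s * P)) + j * (s * P) * x
  collect = solve-∀

≤-absorb-half : ∀ {x a b} → x ≤ a + b → 2 * b ≤ x → x ≤ 2 * a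
≤-absorb-half {x} {a} {b} x≤a+b 2b≤x = +-cancelʳ-≤ x x (2 * a) (begin
    x + x
  ≡⟨ cong (x +_) (sym (+-identityʳ x)) ⟩
    2 * x
  ≤⟨ *-monoʳ-≤ 2 x≤a+b ⟩
    2 * (a + b)
  ≡⟨ *-distribˡ-+ 2 a b ⟩
    2 * a + 2 * b
  ≤⟨ +-monoʳ-≤ (2 * a) 2b≤x ⟩
    2 * a + x
  ∎)
  where open ≤-Reasoning

drc-arithmetic : ∀ j {s P M D B} → suc j * P * (M * s) ≤ B + (suc j * P * D + j * (s * P)) * M →
                 2 * suc j * D ≤ s → s * P * M ≤ 2 * B
drc-arithmetic j {s} {P} {M} {D} {B} bound 2kD≤s = ≤-absorb-half {b = suc j * P * D * M} main
  (subst₂ _≤_ (expand₂ j P D M) (sym (*-assoc s P M)) (*-monoˡ-≤ (P * M) 2kD≤s))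
  where
  expand₁ : ∀ j s P M → suc j * P * (M * s) ≡ s * P * M + j * (s * P) * M
  expand₁ = solve-∀
  expand₂ : ∀ j P D M → 2 * suc j * D * (P * M) ≡ 2 * (suc j * P * D * M)
  expand₂ = solve-∀
  regroup : ∀ B c₁ c₂ M → B + (c₁ + c₂) * M ≡ B + c₁ * M + c₂ * M
  regroup = solve-∀
  main : s * P * M ≤ B + suc j * P * D * M
  main = +-cancelʳ-≤ (j * (s * P) * M) _ _
           (subst₂ _≤_ (expand₁ j s P M) (regroup B (suc j * P * D) (j * (s * P)) M) bound)

-- slack k = 2ᵏ − 1: a greedy step removes its own vertex before the larger side is halved.
slack : ℕ → ℕ
slack zero    = 0
slack (suc k) = suc (2 * slack k)

halving : ∀ {z p q} d → p + q + 1 ≡ z → q ≤ p → z ∸ suc (2 * d) ≤ 2 * (p ∸ d)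
halving {z} {p} {q} d p+q+1≡z q≤p = begin
    z ∸ suc (2 * d)
  ≤⟨ ∸-monoˡ-≤ (suc (2 * d)) z≤2p+1 ⟩
    suc (2 * p) ∸ suc (2 * d)
  ≡⟨ sym (*-distribˡ-∸ 2 p d) ⟩
    2 * (p ∸ d)
  ∎
  where
  open ≤-Reasoning
  z≤2p+1 : z ≤ suc (2 * p)
  z≤2p+1 = begin
      z
    ≡⟨ trans (sym p+q+1≡z) (+-comm (p + q) 1) ⟩
      suc (p + q)
    ≤⟨ s≤s (+-monoʳ-≤ p (≤-trans q≤p (m≤m+n p 0))) ⟩
      suc (2 * p)
    ∎

larger-side-bound : ∀ k d {z p q} F G → p + q + 1 ≡ z → q ≤ p → (p ∸ d) ^ k ≤ 2 ^ (k * k) * F →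
                    (z ∸ suc (2 * d)) ^ k ≤ 2 ^ (suc k * suc k) * (F + G)
larger-side-bound k d {z} {p} F G split q≤p bound = begin
    (z ∸ suc (2 * d)) ^ k
  ≤⟨ ^-monoˡ-≤ k (halving d split q≤p) ⟩
    (2 * (p ∸ d)) ^ k
  ≡⟨ ^-distribʳ-* 2 (p ∸ d) k ⟩
    2 ^ k * (p ∸ d) ^ k
  ≤⟨ *-monoʳ-≤ (2 ^ k) bound ⟩
    2 ^ k * (2 ^ (k * k) * F)
  ≡⟨ trans (sym (*-assoc (2 ^ k) _ F)) (cong (_* F) (sym (^-distribˡ-+-* 2 k (k * k)))) ⟩
    2 ^ (k + k * k) * F
  ≤⟨ *-mono-≤ (^-monoʳ-≤ 2 (subst (k + k * k ≤_) (expand k) (m≤m+n (k + k * k) (suc k)))) (m≤m+n F G) ⟩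
    2 ^ (suc k * suc k) * (F + G)
  ∎
  where
  open ≤-Reasoning
  expand : ∀ k → (k + k * k) + suc k ≡ suc k * suc k
  expand = solve-∀

VSet : ℕ → Set
VSet n = Fin n → Bool

infixl 7 _∩_
_∩_ : ∀ {n} → VSet n → VSet n → VSet n
(Z ∩ P) u = Z u ∧ P u

infix 5 _⊆ᵇ_
_⊆ᵇ_ : ∀ {n} → List (Fin n) → VSet n → Bool
[]      ⊆ᵇ P = true
(v ∷ w) ⊆ᵇ P = P v ∧ (w ⊆ᵇ P)

size : ∀ {n} → VSet n → ℕ
size {n} Z = ∑[ u < n ] 𝟙 (Z u)

size-∩ˡ : ∀ {n} (Z P : VSet n) → size (Z ∩ P) ≤ size Z
size-∩ˡ Z P = sum-mono (λ u → 𝟙-∧≤ˡ (Z u) (P u))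

size-∩ʳ : ∀ {n} (Z P : VSet n) → size (Z ∩ P) ≤ size P
size-∩ʳ Z P = sum-mono (λ u → 𝟙-∧≤ʳ (Z u) (P u))

infix 5 _∈ᵇ_
_∈ᵇ_ : ∀ {n} → Fin n → List (Fin n) → Bool
u ∈ᵇ []      = false
u ∈ᵇ (v ∷ w) = does (u Fin.≟ v) ∨ (u ∈ᵇ w)

toSubset : ∀ {n} → List (Fin n) → Subset n
toSubset w = tabulate (_∈ᵇ w)

∈ᵇ-∷⁻ : ∀ {n} {u v : Fin n} w → u ∈ᵇ (v ∷ w) ≡ true → u ≡ v ⊎ u ∈ᵇ w ≡ true
∈ᵇ-∷⁻ {u = u} {v} w u∈ with u Fin.≟ v
... | yes u≡v = inj₁ u≡v
... | no  _   = inj₂ u∈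

⊆ᵇ-sound : ∀ {n} {P : VSet n} w → w ⊆ᵇ P ≡ true → ∀ {u} → u ∈ᵇ w ≡ true → P u ≡ true
⊆ᵇ-sound {P = P} (v ∷ w) w⊆P {u} u∈ with ∈ᵇ-∷⁻ w u∈
... | inj₁ refl = ∧-conicalˡ (P v) _ w⊆P
... | inj₂ u∈w  = ⊆ᵇ-sound w (∧-conicalʳ (P v) _ w⊆P) u∈w

⊆ᵇ-complete : ∀ {n} {P : VSet n} w → (∀ {u} → u ∈ᵇ w ≡ true → P u ≡ true) → w ⊆ᵇ P ≡ true
⊆ᵇ-complete []      _    = refl
⊆ᵇ-complete (v ∷ w) w⊆P =
  cong₂ _∧_ (w⊆P (cong (_∨ (v ∈ᵇ w)) (dec-true (v Fin.≟ v) refl))) (⊆ᵇ-complete w (w⊆P ∘ ∨-true-right))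
  where
  ∨-true-right : ∀ {a b} → b ≡ true → a ∨ b ≡ true
  ∨-true-right {a} refl = ∨-zeroʳ a

⊆ᵇ-mono : ∀ {n} {P Q : VSet n} w → (∀ {u} → P u ≡ true → Q u ≡ true) → w ⊆ᵇ P ≡ true → w ⊆ᵇ Q ≡ true
⊆ᵇ-mono w P⊆Q w⊆P = ⊆ᵇ-complete w (P⊆Q ∘ ⊆ᵇ-sound w w⊆P)

⊆ᵇ-∩ˡ : ∀ {n} {P Q : VSet n} w → w ⊆ᵇ P ∩ Q ≡ true → w ⊆ᵇ P ≡ true
⊆ᵇ-∩ˡ {P = P} {Q} w = ⊆ᵇ-mono w (λ {u} → ∧-conicalˡ (P u) (Q u))

⊆ᵇ-∩ʳ : ∀ {n} {P Q : VSet n} w → w ⊆ᵇ P ∩ Q ≡ true → w ⊆ᵇ Q ≡ true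
⊆ᵇ-∩ʳ {P = P} {Q} w = ⊆ᵇ-mono w (λ {u} → ∧-conicalʳ (P u) (Q u))

⊆ᵇ-∉ : ∀ {n} {P : VSet n} {u} w → w ⊆ᵇ P ≡ true → P u ≡ false → u ∈ᵇ w ≡ false
⊆ᵇ-∉ {u = u} w w⊆P u∉P with u ∈ᵇ w in u∈w
... | false = refl
... | true  = trans (sym (⊆ᵇ-sound w w⊆P u∈w)) u∉P

size-∈ᵇ-∷ : ∀ {n} {v : Fin n} w → v ∈ᵇ w ≡ false → size (_∈ᵇ (v ∷ w)) ≡ suc (size (_∈ᵇ w))
size-∈ᵇ-∷ {n} {v} w v∉w = begin
    ∑[ u < n ] 𝟙 (does (u Fin.≟ v) ∨ (u ∈ᵇ w))
  ≡⟨ sum-cong-≗ disjoint ⟩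
    ∑[ u < n ] (𝟙 (does (u Fin.≟ v)) + 𝟙 (u ∈ᵇ w))
  ≡⟨ ∑-distrib-+ (λ u → 𝟙 (does (u Fin.≟ v))) (λ u → 𝟙 (u ∈ᵇ w)) ⟩
    ∑[ u < n ] 𝟙 (does (u Fin.≟ v)) + size (_∈ᵇ w)
  ≡⟨ cong (_+ size (_∈ᵇ w)) (∑-𝟙-≟ v) ⟩
    suc (size (_∈ᵇ w))
  ∎
  where
  open ≡-Reasoning
  disjoint : ∀ u → 𝟙 (does (u Fin.≟ v) ∨ (u ∈ᵇ w)) ≡ 𝟙 (does (u Fin.≟ v)) + 𝟙 (u ∈ᵇ w)
  disjoint u with u Fin.≟ v
  ... | yes refl rewrite v∉w = refl
  ... | no  _    = refl

allIn-sound : ∀ {n} (S : Subset n) {f : Fin n → Bool} → allIn S f ≡ true → ∀ {i} → lookup S i ≡ true → f i ≡ true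
allIn-sound (true ∷ S)  all {fzero}  _   = ∧-conicalˡ _ _ all
allIn-sound (b ∷ S)     all {fsuc i} i∈S = allIn-sound S (∧-conicalʳ (not b ∨ _) _ all) i∈S

allIn-complete : ∀ {n} (S : Subset n) {f : Fin n → Bool} → (∀ {i} → lookup S i ≡ true → f i ≡ true) → allIn S f ≡ true
allIn-complete []          _   = refl
allIn-complete (true ∷ S)  S⊆f rewrite S⊆f {fzero} refl = allIn-complete S (S⊆f {fsuc _})
allIn-complete (false ∷ S) S⊆f = allIn-complete S (S⊆f {fsuc _})

allIn-toSubset : ∀ {n} (w : List (Fin n)) (f : Fin n → Bool) → allIn (toSubset w) f ≡ (w ⊆ᵇ f)
allIn-toSubset w f = ⇔→≡ {z = true} (mk⇔
  (λ all → ⊆ᵇ-complete w (λ {u} u∈w → allIn-sound (toSubset w) all (trans (lookup∘tabulate _ u) u∈w)))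
  (λ w⊆f → allIn-complete (toSubset w) (λ {i} i∈ → ⊆ᵇ-sound w w⊆f (trans (sym (lookup∘tabulate _ i)) i∈))))

∑ˡ : ∀ {a} {B : Set a} → List B → (B → ℕ) → ℕ
∑ˡ []       g = 0
∑ˡ (x ∷ xs) g = g x + ∑ˡ xs g

∑ˡ-mono : ∀ {a} {B : Set a} (xs : List B) {f g : B → ℕ} → (∀ x → f x ≤ g x) → ∑ˡ xs f ≤ ∑ˡ xs g
∑ˡ-mono []       f≤g = z≤n
∑ˡ-mono (x ∷ xs) f≤g = +-mono-≤ (f≤g x) (∑ˡ-mono xs f≤g)

∑ˡ-*ʳ : ∀ {a} {B : Set a} (xs : List B) (g : B → ℕ) c → ∑ˡ xs (λ x → g x * c) ≡ ∑ˡ xs g * c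
∑ˡ-*ʳ []       g c = refl
∑ˡ-*ʳ (x ∷ xs) g c = trans (cong (g x * c +_) (∑ˡ-*ʳ xs g c)) (sym (*-distribʳ-+ c (g x) _))

∑ˡ-∈ : ∀ {a} {B : Set a} {xs : List B} {x} (g : B → ℕ) → x ∈ˡ xs → g x ≤ ∑ˡ xs g
∑ˡ-∈ g (here refl)  = m≤m+n _ _
∑ˡ-∈ g (there x∈xs) = ≤-trans (∑ˡ-∈ g x∈xs) (m≤n+m _ _)

length-filterᵇ : ∀ {a} {B : Set a} (p : B → Bool) xs → length (filterᵇ p xs) ≡ ∑ˡ xs (𝟙 ∘ p)
length-filterᵇ p []       = refl
length-filterᵇ p (x ∷ xs) with p x
... | true  = cong suc (length-filterᵇ p xs)
... | false = length-filterᵇ p xs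

∈-allSubsets : ∀ {n} (S : Subset n) → S ∈ˡ allSubsets n
∈-allSubsets []          = here refl
∈-allSubsets (false ∷ S) = ∈-++⁺ˡ (∈-map⁺ (false ∷_) (∈-allSubsets S))
∈-allSubsets (true ∷ S)  = ∈-++⁺ʳ (map (false ∷_) (allSubsets _)) (∈-map⁺ (true ∷_) (∈-allSubsets S))

TransitiveOn : ∀ {n} → (Fin n → Fin n → Set) → VSet n → Set
TransitiveOn R S = ∀ {x y z} → S x ≡ true → S y ≡ true → S z ≡ true → R x y → R y z → R x z

TransitiveOn-flip : ∀ {n} {R : Fin n → Fin n → Set} {S} → TransitiveOn R S → TransitiveOn (flip R) S
TransitiveOn-flip tr x∈S y∈S z∈S Ryx Rzy = tr z∈S y∈S x∈S Rzy Ryx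

TransitiveOn-source : ∀ {n} {R : Fin n → Fin n → Set} {v} w → Asymmetric R →
                      (∀ {u} → u ∈ᵇ w ≡ true → R v u) →
                      TransitiveOn R (_∈ᵇ w) → TransitiveOn R (_∈ᵇ (v ∷ w))
TransitiveOn-source w asym v→w tr {x} {y} {z} x∈ y∈ z∈ Rxy Ryz
  with ∈ᵇ-∷⁻ w x∈ | ∈ᵇ-∷⁻ w y∈ | ∈ᵇ-∷⁻ w z∈
... | inj₁ refl | _         | inj₁ refl = ⊥-elim (asym Rxy Ryz)
... | inj₁ refl | _         | inj₂ z∈w  = v→w z∈w
... | inj₂ x∈w  | inj₁ refl | _         = ⊥-elim (asym Rxy (v→w x∈w))
... | inj₂ _    | inj₂ y∈w  | inj₁ refl = ⊥-elim (asym Ryz (v→w y∈w))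
... | inj₂ x∈w  | inj₂ y∈w  | inj₂ z∈w  = tr x∈w y∈w z∈w Rxy Ryz

TransitiveOn-sink : ∀ {n} {R : Fin n → Fin n → Set} {v} w → Asymmetric R →
                    (∀ {u} → u ∈ᵇ w ≡ true → R u v) →
                    TransitiveOn R (_∈ᵇ w) → TransitiveOn R (_∈ᵇ (v ∷ w))
TransitiveOn-sink {R = R} {v} w asym w→v tr =
  TransitiveOn-flip {R = flip R} {S = _∈ᵇ (v ∷ w)}
    (TransitiveOn-source {R = flip R} w (λ Rba Rab → asym Rab Rba) w→v (TransitiveOn-flip {R = R} tr))

-- Greedy sequences in a tournament

module _ {n : ℕ} (T : Tournament n) where

  N⁺ N⁻ : Fin n → VSet n
  N⁺ v u = E T v u
  N⁻ v u = E T u v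

  size-split : ∀ (Z : VSet n) {v} → Z v ≡ true →
               size (Z ∩ N⁺ v) + size (Z ∩ N⁻ v) + 1 ≡ size Z
  size-split Z {v} v∈Z = begin
      ∑[ u < n ] o u + ∑[ u < n ] i u + 1
    ≡⟨ cong₂ _+_ (sym (∑-distrib-+ o i)) (sym (∑-𝟙-≟ v)) ⟩
      ∑[ u < n ] (o u + i u) + ∑[ u < n ] d u
    ≡⟨ sym (∑-distrib-+ (λ u → o u + i u) d) ⟩
      ∑[ u < n ] (o u + i u + d u)
    ≡⟨ sum-cong-≗ exactly-one ⟩
      size Z
    ∎
    where
    open ≡-Reasoning
    o i d : Fin n → ℕ
    o u = 𝟙 (Z u ∧ E T v u)
    i u = 𝟙 (Z u ∧ E T u v)
    d u = 𝟙 (does (u Fin.≟ v))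
    exactly-one : ∀ u → o u + i u + d u ≡ 𝟙 (Z u)
    exactly-one u with u Fin.≟ v
    ... | yes refl rewrite irrefl T u | v∈Z = refl
    ... | no u≢v rewrite tourn T v u (u≢v ∘ sym) with Z u | E T v u
    ... | true  | true  = refl
    ... | true  | false = refl
    ... | false | _     = refl

  -- Both sides are counted even when the
  -- remaining steps cannot tell them apart, so e.g. #greedy 1 Z = 2 · size Z.
  ∑greedy      : ℕ → VSet n → (List (Fin n) → ℕ) → ℕ
  ∑greedy-from : ℕ → VSet n → (List (Fin n) → ℕ) → Fin n → ℕ

  ∑greedy zero    Z f = f []
  ∑greedy (suc k) Z f = ∑[ v < n ] (𝟙 (Z v) * ∑greedy-from k Z f v)

  ∑greedy-from k Z f v = ∑greedy k (Z ∩ N⁺ v) (f ∘ (v ∷_)) + ∑greedy k (Z ∩ N⁻ v) (f ∘ (v ∷_))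

  #greedy : ℕ → VSet n → ℕ
  #greedy k Z = ∑greedy k Z (λ _ → 1)

  data Greedy : ℕ → VSet n → List (Fin n) → Set where
    []   : ∀ {Z} → Greedy zero Z []
    _⁺∷_ : ∀ {k Z v w} → Z v ≡ true → Greedy k (Z ∩ N⁺ v) w → Greedy (suc k) Z (v ∷ w)
    _⁻∷_ : ∀ {k Z v w} → Z v ≡ true → Greedy k (Z ∩ N⁻ v) w → Greedy (suc k) Z (v ∷ w)

  ∑greedy-cong : ∀ k {Z Z′ : VSet n} {f g : List (Fin n) → ℕ} →
                 (∀ u → Z u ≡ Z′ u) → (∀ w → f w ≡ g w) → ∑greedy k Z f ≡ ∑greedy k Z′ g
  ∑greedy-cong zero    Z≗Z′ f≗g = f≗g []
  ∑greedy-cong (suc k) Z≗Z′ f≗g = sum-cong-≗ λ v →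
    cong₂ _*_ (cong 𝟙 (Z≗Z′ v))
      (cong₂ _+_ (∑greedy-cong k (λ u → cong (_∧ E T v u) (Z≗Z′ u)) (f≗g ∘ (v ∷_)))
                 (∑greedy-cong k (λ u → cong (_∧ E T u v) (Z≗Z′ u)) (f≗g ∘ (v ∷_))))

  ∑greedy-+ : ∀ k Z (f g : List (Fin n) → ℕ) →
              ∑greedy k Z (λ w → f w + g w) ≡ ∑greedy k Z f + ∑greedy k Z g
  ∑greedy-+ zero    Z f g = refl
  ∑greedy-+ (suc k) Z f g =
    trans (sum-cong-≗ step) (∑-distrib-+ (λ v → 𝟙 (Z v) * ∑greedy-from k Z f v) (λ v → 𝟙 (Z v) * ∑greedy-from k Z g v))
    where
    regroup : ∀ a b c d e → a * ((b + c) + (d + e)) ≡ a * (b + d) + a * (c + e)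
    regroup = solve-∀
    step : ∀ v → 𝟙 (Z v) * ∑greedy-from k Z (λ w → f w + g w) v
               ≡ 𝟙 (Z v) * ∑greedy-from k Z f v + 𝟙 (Z v) * ∑greedy-from k Z g v
    step v = trans (cong (𝟙 (Z v) *_) (cong₂ _+_ (∑greedy-+ k Z⁺ fᵥ gᵥ) (∑greedy-+ k Z⁻ fᵥ gᵥ)))
                   (regroup (𝟙 (Z v)) (∑greedy k Z⁺ fᵥ) (∑greedy k Z⁺ gᵥ) (∑greedy k Z⁻ fᵥ) (∑greedy k Z⁻ gᵥ))
      where
      Z⁺ = Z ∩ N⁺ v
      Z⁻ = Z ∩ N⁻ v
      fᵥ = f ∘ (v ∷_)
      gᵥ = g ∘ (v ∷_)

  ∑greedy-* : ∀ k Z c (f : List (Fin n) → ℕ) → ∑greedy k Z (λ w → c * f w) ≡ c * ∑greedy k Z f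
  ∑greedy-* zero    Z c f = refl
  ∑greedy-* (suc k) Z c f =
    trans (sum-cong-≗ step) (sym (*-distribˡ-sum c (λ v → 𝟙 (Z v) * ∑greedy-from k Z f v)))
    where
    regroup : ∀ a c b d → a * (c * b + c * d) ≡ c * (a * (b + d))
    regroup = solve-∀
    step : ∀ v → 𝟙 (Z v) * ∑greedy-from k Z (λ w → c * f w) v ≡ c * (𝟙 (Z v) * ∑greedy-from k Z f v)
    step v = trans (cong (𝟙 (Z v) *_) (cong₂ _+_ (∑greedy-* k Z⁺ c fᵥ) (∑greedy-* k Z⁻ c fᵥ)))
                   (regroup (𝟙 (Z v)) c (∑greedy k Z⁺ fᵥ) (∑greedy k Z⁻ fᵥ))
      where
      Z⁺ = Z ∩ N⁺ v
      Z⁻ = Z ∩ N⁻ v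
      fᵥ = f ∘ (v ∷_)

  ∑greedy-zero : ∀ k Z → ∑greedy k Z (λ _ → 0) ≡ 0
  ∑greedy-zero k Z = ∑greedy-* k Z 0 (λ _ → 0)

  ∑greedy-sum : ∀ k Z {m} (g : Fin m → List (Fin n) → ℕ) →
                ∑greedy k Z (λ w → ∑[ a < m ] g a w) ≡ ∑[ a < m ] ∑greedy k Z (g a)
  ∑greedy-sum k Z {zero}  g = ∑greedy-zero k Z
  ∑greedy-sum k Z {suc m} g =
    trans (∑greedy-+ k Z (g fzero) (λ w → ∑[ a < m ] g (fsuc a) w))
          (cong (∑greedy k Z (g fzero) +_) (∑greedy-sum k Z (g ∘ fsuc)))

  ∑greedy-∑ˡ : ∀ k Z {a} {B : Set a} (xs : List B) (g : B → List (Fin n) → ℕ) →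
               ∑greedy k Z (λ w → ∑ˡ xs (λ x → g x w)) ≡ ∑ˡ xs (λ x → ∑greedy k Z (g x))
  ∑greedy-∑ˡ k Z []       g = ∑greedy-zero k Z
  ∑greedy-∑ˡ k Z (x ∷ xs) g =
    trans (∑greedy-+ k Z (g x) (λ w → ∑ˡ xs (λ y → g y w))) (cong (∑greedy k Z (g x) +_) (∑greedy-∑ˡ k Z xs g))

  ∑greedy-mono : ∀ k Z {f g : List (Fin n) → ℕ} →
                 (∀ {w} → Greedy k Z w → f w ≤ g w) → ∑greedy k Z f ≤ ∑greedy k Z g
  ∑greedy-mono zero    Z f≤g = f≤g []
  ∑greedy-mono (suc k) Z {f} {g} f≤g = sum-mono step
    where
    step : ∀ v → 𝟙 (Z v) * ∑greedy-from k Z f v ≤ 𝟙 (Z v) * ∑greedy-from k Z g v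
    step v with Z v in v∈Z
    ... | false = z≤n
    ... | true  = *-monoʳ-≤ 1 (+-mono-≤ (∑greedy-mono k _ (f≤g ∘ (v∈Z ⁺∷_)))
                                        (∑greedy-mono k _ (f≤g ∘ (v∈Z ⁻∷_))))

  ∑greedy-restrict : ∀ k Z P (f : List (Fin n) → ℕ) →
                     ∑greedy k Z (λ w → f w * 𝟙 (w ⊆ᵇ P)) ≡ ∑greedy k (Z ∩ P) f
  ∑greedy-restrict zero    Z P f = *-identityʳ (f [])
  ∑greedy-restrict (suc k) Z P f = sum-cong-≗ step
    where
    step : ∀ v → 𝟙 (Z v) * ∑greedy-from k Z (λ w → f w * 𝟙 (w ⊆ᵇ P)) v
               ≡ 𝟙 (Z v ∧ P v) * ∑greedy-from k (Z ∩ P) f v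
    step v = begin
        𝟙 (Z v) * (restricted (N⁺ v) + restricted (N⁻ v))
      ≡⟨ cong (𝟙 (Z v) *_) (cong₂ _+_ (pull (N⁺ v)) (pull (N⁻ v))) ⟩
        𝟙 (Z v) * (𝟙 (P v) * ∑greedy k (Z ∩ P ∩ N⁺ v) fᵥ + 𝟙 (P v) * ∑greedy k (Z ∩ P ∩ N⁻ v) fᵥ)
      ≡⟨ regroup (𝟙 (Z v)) (𝟙 (P v)) _ _ ⟩
        𝟙 (Z v) * 𝟙 (P v) * ∑greedy-from k (Z ∩ P) f v
      ≡⟨ cong (_* ∑greedy-from k (Z ∩ P) f v) (sym (𝟙-∧ (Z v) (P v))) ⟩
        𝟙 (Z v ∧ P v) * ∑greedy-from k (Z ∩ P) f v
      ∎
      where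
      open ≡-Reasoning
      fᵥ = f ∘ (v ∷_)
      regroup : ∀ a b c d → a * (b * c + b * d) ≡ a * b * (c + d)
      regroup = solve-∀
      restricted : VSet n → ℕ
      restricted Q = ∑greedy k (Z ∩ Q) (λ w → f (v ∷ w) * 𝟙 (P v ∧ (w ⊆ᵇ P)))
      swap : ∀ Q u → (Z ∩ Q) u ∧ P u ≡ (Z ∩ P ∩ Q) u
      swap Q u = trans (∧-assoc (Z u) (Q u) (P u))
                       (trans (cong (Z u ∧_) (∧-comm (Q u) (P u))) (sym (∧-assoc (Z u) (P u) (Q u))))
      pull : ∀ Q → restricted Q ≡ 𝟙 (P v) * ∑greedy k (Z ∩ P ∩ Q) fᵥ
      pull Q = begin
          restricted Q
        ≡⟨ ∑greedy-cong k (λ _ → refl) (λ w → cong (f (v ∷ w) *_) (𝟙-∧ (P v) (w ⊆ᵇ P))) ⟩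
          ∑greedy k (Z ∩ Q) (λ w → f (v ∷ w) * (𝟙 (P v) * 𝟙 (w ⊆ᵇ P)))
        ≡⟨ ∑greedy-cong k (λ _ → refl) (λ w → x∙yz≈y∙xz (f (v ∷ w)) (𝟙 (P v)) (𝟙 (w ⊆ᵇ P))) ⟩
          ∑greedy k (Z ∩ Q) (λ w → 𝟙 (P v) * (fᵥ w * 𝟙 (w ⊆ᵇ P)))
        ≡⟨ ∑greedy-* k (Z ∩ Q) (𝟙 (P v)) _ ⟩
          𝟙 (P v) * ∑greedy k (Z ∩ Q) (λ w → fᵥ w * 𝟙 (w ⊆ᵇ P))
        ≡⟨ cong (𝟙 (P v) *_) (∑greedy-restrict k (Z ∩ Q) P fᵥ) ⟩
          𝟙 (P v) * ∑greedy k (Z ∩ Q ∩ P) fᵥ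
        ≡⟨ cong (𝟙 (P v) *_) (∑greedy-cong k (swap Q) (λ _ → refl)) ⟩
          𝟙 (P v) * ∑greedy k (Z ∩ P ∩ Q) fᵥ
        ∎

  #greedy-restrict : ∀ k Z P → ∑greedy k Z (λ w → 𝟙 (w ⊆ᵇ P)) ≡ #greedy k (Z ∩ P)
  #greedy-restrict k Z P =
    trans (∑greedy-cong k (λ _ → refl) (λ w → sym (*-identityˡ (𝟙 (w ⊆ᵇ P))))) (∑greedy-restrict k Z P (λ _ → 1))

  #greedy-upper : ∀ k Z → #greedy k Z ≤ 2 ^ k * size Z ^ k
  #greedy-upper zero    Z = ≤-refl
  #greedy-upper (suc k) Z = begin
      ∑[ v < n ] (𝟙 (Z v) * (#greedy k (Z ∩ N⁺ v) + #greedy k (Z ∩ N⁻ v)))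
    ≤⟨ sum-mono (λ v → *-monoʳ-≤ (𝟙 (Z v)) (+-mono-≤ (shrink (N⁺ v)) (shrink (N⁻ v)))) ⟩
      ∑[ v < n ] (𝟙 (Z v) * (b + b))
    ≡⟨ sym (*-distribʳ-sum (b + b) (𝟙 ∘ Z)) ⟩
      size Z * (b + b)
    ≡⟨ regroup (size Z) (2 ^ k) (size Z ^ k) ⟩
      2 ^ suc k * size Z ^ suc k
    ∎
    where
    open ≤-Reasoning
    b = 2 ^ k * size Z ^ k
    shrink : ∀ P → #greedy k (Z ∩ P) ≤ b
    shrink P = ≤-trans (#greedy-upper k (Z ∩ P)) (*-monoʳ-≤ (2 ^ k) (^-monoˡ-≤ k (size-∩ˡ Z P)))
    regroup : ∀ z a c → z * (a * c + a * c) ≡ (2 * a) * (z * c)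
    regroup = solve-∀

  #greedy-lower : ∀ k Z → (size Z ∸ slack k) ^ k ≤ 2 ^ (k * k) * #greedy k Z
  #greedy-lower zero    Z = ≤-refl
  #greedy-lower (suc k) Z = begin
      (size Z ∸ slack (suc k)) ^ suc k
    ≤⟨ *-monoˡ-≤ x (m∸n≤m (size Z) (slack (suc k))) ⟩
      size Z * x
    ≡⟨ *-distribʳ-sum x (𝟙 ∘ Z) ⟩
      ∑[ v < n ] (𝟙 (Z v) * x)
    ≤⟨ sum-mono (λ v → 𝟙*-mono (Z v) (from-lower v)) ⟩
      ∑[ v < n ] (𝟙 (Z v) * (2 ^ (suc k * suc k) * ∑greedy-from k Z (λ _ → 1) v))
    ≡⟨ sum-cong-≗ (λ v → x∙yz≈y∙xz (𝟙 (Z v)) (2 ^ (suc k * suc k)) _) ⟩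
      ∑[ v < n ] (2 ^ (suc k * suc k) * (𝟙 (Z v) * ∑greedy-from k Z (λ _ → 1) v))
    ≡⟨ sym (*-distribˡ-sum (2 ^ (suc k * suc k)) (λ v → 𝟙 (Z v) * ∑greedy-from k Z (λ _ → 1) v)) ⟩
      2 ^ (suc k * suc k) * #greedy (suc k) Z
    ∎
    where
    open ≤-Reasoning
    x = (size Z ∸ slack (suc k)) ^ k
    F⁺ F⁻ : Fin n → ℕ
    F⁺ v = #greedy k (Z ∩ N⁺ v)
    F⁻ v = #greedy k (Z ∩ N⁻ v)
    from-lower : ∀ v → Z v ≡ true → x ≤ 2 ^ (suc k * suc k) * ∑greedy-from k Z (λ _ → 1) v
    from-lower v v∈Z with ≤-total (size (Z ∩ N⁻ v)) (size (Z ∩ N⁺ v))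
    ... | inj₁ ≤⁺ = larger-side-bound k (slack k) (F⁺ v) (F⁻ v) (size-split Z v∈Z) ≤⁺
                                    (#greedy-lower k (Z ∩ N⁺ v))
    ... | inj₂ ≤⁻ = subst (λ F → x ≤ 2 ^ (suc k * suc k) * F) (+-comm (F⁻ v) (F⁺ v))
                      (larger-side-bound k (slack k) (F⁻ v) (F⁺ v)
                         (trans (cong (_+ 1) (+-comm (size (Z ∩ N⁻ v)) _)) (size-split Z v∈Z)) ≤⁻
                         (#greedy-lower k (Z ∩ N⁻ v)))

  #greedy-one : ∀ Z → #greedy 1 Z ≡ 2 * size Z
  #greedy-one Z = trans (sum-cong-≗ (λ v → *-comm (𝟙 (Z v)) 2)) (sym (*-distribˡ-sum 2 (𝟙 ∘ Z)))

  tangent-bound : ∀ j s Z →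
    suc j * s ^ j * size Z ≤ 2 ^ (suc j * suc j) * #greedy (suc j) Z + (suc j * s ^ j * slack (suc j) + j * s ^ suc j)
  tangent-bound j s Z = begin
      k * P * size Z
    ≤⟨ *-monoʳ-≤ (k * P) (m≤n+m∸n (size Z) D) ⟩
      k * P * (D + x)
    ≡⟨ trans (cong (k * P *_) (+-comm D x)) (*-distribˡ-+ (k * P) x D) ⟩
      k * P * x + k * P * D
    ≤⟨ +-monoˡ-≤ _ (tangent-line j x s) ⟩
      x ^ k + j * s ^ k + k * P * D
    ≤⟨ +-monoˡ-≤ _ (+-monoˡ-≤ _ (#greedy-lower k Z)) ⟩
      2 ^ (k * k) * #greedy k Z + j * s ^ k + k * P * D
    ≡⟨ +-assoc (2 ^ (k * k) * #greedy k Z) _ _ ⟩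
      2 ^ (k * k) * #greedy k Z + (j * s ^ k + k * P * D)
    ≡⟨ cong (2 ^ (k * k) * #greedy k Z +_) (+-comm (j * s ^ k) _) ⟩
      2 ^ (k * k) * #greedy k Z + (k * P * D + j * s ^ k)
    ∎
    where
    open ≤-Reasoning
    k = suc j
    P = s ^ j
    D = slack k
    x = size Z ∸ D

  Arc : Fin n → Fin n → Set
  Arc a b = E T a b ≡ true

  Arc-asym : Asymmetric Arc
  Arc-asym {a} {b} a→b b→a with a Fin.≟ b
  ... | yes refl = case trans (sym a→b) (irrefl T a) of λ ()
  ... | no a≢b   = case trans (sym b→a) (trans (tourn T a b a≢b) (cong not a→b)) of λ ()

  Greedy-⊆ᵇ : ∀ {k Z w} → Greedy k Z w → w ⊆ᵇ Z ≡ true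
  Greedy-⊆ᵇ []              = refl
  Greedy-⊆ᵇ (_⁺∷_ {Z = Z} {v} {w} v∈Z greedy) = cong₂ _∧_ v∈Z (⊆ᵇ-∩ˡ {Q = N⁺ v} w (Greedy-⊆ᵇ greedy))
  Greedy-⊆ᵇ (_⁻∷_ {Z = Z} {v} {w} v∈Z greedy) = cong₂ _∧_ v∈Z (⊆ᵇ-∩ˡ {Q = N⁻ v} w (Greedy-⊆ᵇ greedy))

  v∉Z∩N⁺v : ∀ Z v → (Z ∩ N⁺ v) v ≡ false
  v∉Z∩N⁺v Z v = trans (cong (Z v ∧_) (irrefl T v)) (∧-zeroʳ (Z v))

  v∉Z∩N⁻v : ∀ Z v → (Z ∩ N⁻ v) v ≡ false
  v∉Z∩N⁻v Z v = trans (cong (Z v ∧_) (irrefl T v)) (∧-zeroʳ (Z v))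

  Greedy-size : ∀ {k Z w} → Greedy k Z w → size (_∈ᵇ w) ≡ k
  Greedy-size []                                      = sum-replicate-zero n
  Greedy-size (_⁺∷_ {Z = Z} {v} {w} _ greedy) =
    trans (size-∈ᵇ-∷ w (⊆ᵇ-∉ w (Greedy-⊆ᵇ greedy) (v∉Z∩N⁺v Z v))) (cong suc (Greedy-size greedy))
  Greedy-size (_⁻∷_ {Z = Z} {v} {w} _ greedy) =
    trans (size-∈ᵇ-∷ w (⊆ᵇ-∉ w (Greedy-⊆ᵇ greedy) (v∉Z∩N⁻v Z v))) (cong suc (Greedy-size greedy))

  Greedy-transitive : ∀ {k Z w} → Greedy k Z w → TransitiveOn Arc (_∈ᵇ w)
  Greedy-transitive [] ()
  Greedy-transitive (_⁺∷_ {Z = Z} {v} {w} _ greedy) = TransitiveOn-source w Arc-asym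
    (⊆ᵇ-sound w (⊆ᵇ-∩ʳ {P = Z} {N⁺ v} w (Greedy-⊆ᵇ greedy))) (Greedy-transitive greedy)
  Greedy-transitive (_⁻∷_ {Z = Z} {v} {w} _ greedy) = TransitiveOn-sink w Arc-asym
    (⊆ᵇ-sound w (⊆ᵇ-∩ʳ {P = Z} {N⁻ v} w (Greedy-⊆ᵇ greedy))) (Greedy-transitive greedy)

  -- Dependent random choice

  module _ (A : VSet n) where

    ∑tuples : ℕ → (VSet n → ℕ) → VSet n → ℕ
    ∑tuples zero    φ Z = φ Z
    ∑tuples (suc t) φ Z = ∑[ a < n ] (𝟙 (A a) * ∑tuples t φ (Z ∩ N⁻ a))

    #dominated : List (Fin n) → ℕ
    #dominated w = ∑[ a < n ] (𝟙 (A a) * 𝟙 (w ⊆ᵇ N⁻ a))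

    ∑tuples-mono : ∀ t {φ ψ : VSet n → ℕ} → (∀ Z → φ Z ≤ ψ Z) → ∀ Z → ∑tuples t φ Z ≤ ∑tuples t ψ Z
    ∑tuples-mono zero    φ≤ψ Z = φ≤ψ Z
    ∑tuples-mono (suc t) φ≤ψ Z = sum-mono (λ a → *-monoʳ-≤ (𝟙 (A a)) (∑tuples-mono t φ≤ψ (Z ∩ N⁻ a)))

    ∑tuples-cong : ∀ t {φ ψ : VSet n → ℕ} → (∀ Y → φ Y ≡ ψ Y) → ∀ Z → ∑tuples t φ Z ≡ ∑tuples t ψ Z
    ∑tuples-cong zero    φ≗ψ Z = φ≗ψ Z
    ∑tuples-cong (suc t) φ≗ψ Z = sum-cong-≗ (λ a → cong (𝟙 (A a) *_) (∑tuples-cong t φ≗ψ (Z ∩ N⁻ a)))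

    ∑tuples-+ : ∀ t (φ ψ : VSet n → ℕ) Z → ∑tuples t (λ Y → φ Y + ψ Y) Z ≡ ∑tuples t φ Z + ∑tuples t ψ Z
    ∑tuples-+ zero    φ ψ Z = refl
    ∑tuples-+ (suc t) φ ψ Z =
      trans (sum-cong-≗ (λ a → trans (cong (𝟙 (A a) *_) (∑tuples-+ t φ ψ (Z ∩ N⁻ a)))
                                     (*-distribˡ-+ (𝟙 (A a)) _ _)))
            (∑-distrib-+ (λ a → 𝟙 (A a) * ∑tuples t φ (Z ∩ N⁻ a)) (λ a → 𝟙 (A a) * ∑tuples t ψ (Z ∩ N⁻ a)))

    ∑tuples-* : ∀ t c (φ : VSet n → ℕ) Z → ∑tuples t (λ Y → c * φ Y) Z ≡ c * ∑tuples t φ Z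
    ∑tuples-* zero    c φ Z = refl
    ∑tuples-* (suc t) c φ Z =
      trans (sum-cong-≗ (λ a → trans (cong (𝟙 (A a) *_) (∑tuples-* t c φ (Z ∩ N⁻ a)))
                                     (x∙yz≈y∙xz (𝟙 (A a)) c _)))
            (sym (*-distribˡ-sum c (λ a → 𝟙 (A a) * ∑tuples t φ (Z ∩ N⁻ a))))

    ∑tuples-const : ∀ t c Z → ∑tuples t (λ _ → c) Z ≡ c * size A ^ t
    ∑tuples-const zero    c Z = sym (*-identityʳ c)
    ∑tuples-const (suc t) c Z = begin
        ∑[ a < n ] (𝟙 (A a) * ∑tuples t (λ _ → c) (Z ∩ N⁻ a))
      ≡⟨ sum-cong-≗ (λ a → cong (𝟙 (A a) *_) (∑tuples-const t c (Z ∩ N⁻ a))) ⟩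
        ∑[ a < n ] (𝟙 (A a) * (c * size A ^ t))
      ≡⟨ sym (*-distribʳ-sum (c * size A ^ t) (𝟙 ∘ A)) ⟩
        size A * (c * size A ^ t)
      ≡⟨ x∙yz≈y∙xz (size A) c (size A ^ t) ⟩
        c * size A ^ suc t
      ∎
      where open ≡-Reasoning

    -- Double counting: a greedy sequence w lies inside Z ∩ N⁻ a₁ ∩ ⋯ ∩ N⁻ aₜ exactly when
    -- every aᵢ is dominated by all of w.
    ∑tuples-#greedy : ∀ t k Z → ∑tuples t (#greedy k) Z ≡ ∑greedy k Z (λ w → #dominated w ^ t)
    ∑tuples-#greedy zero    k Z = refl
    ∑tuples-#greedy (suc t) k Z = begin
        ∑[ a < n ] (𝟙 (A a) * ∑tuples t (#greedy k) (Z ∩ N⁻ a))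
      ≡⟨ sum-cong-≗ (λ a → cong (𝟙 (A a) *_) (∑tuples-#greedy t k (Z ∩ N⁻ a))) ⟩
        ∑[ a < n ] (𝟙 (A a) * ∑greedy k (Z ∩ N⁻ a) H)
      ≡⟨ sum-cong-≗ (λ a → cong (𝟙 (A a) *_) (sym (∑greedy-restrict k Z (N⁻ a) H))) ⟩
        ∑[ a < n ] (𝟙 (A a) * ∑greedy k Z (λ w → H w * 𝟙 (w ⊆ᵇ N⁻ a)))
      ≡⟨ sum-cong-≗ (λ a → sym (∑greedy-* k Z (𝟙 (A a)) _)) ⟩
        ∑[ a < n ] ∑greedy k Z (λ w → 𝟙 (A a) * (H w * 𝟙 (w ⊆ᵇ N⁻ a)))
      ≡⟨ sym (∑greedy-sum k Z (λ a w → 𝟙 (A a) * (H w * 𝟙 (w ⊆ᵇ N⁻ a)))) ⟩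
        ∑greedy k Z (λ w → ∑[ a < n ] (𝟙 (A a) * (H w * 𝟙 (w ⊆ᵇ N⁻ a))))
      ≡⟨ ∑greedy-cong k (λ _ → refl) pull-out ⟩
        ∑greedy k Z (λ w → #dominated w ^ suc t)
      ∎
      where
      open ≡-Reasoning
      H : List (Fin n) → ℕ
      H w = #dominated w ^ t
      pull-out : ∀ w → ∑[ a < n ] (𝟙 (A a) * (H w * 𝟙 (w ⊆ᵇ N⁻ a))) ≡ #dominated w ^ suc t
      pull-out w = begin
          ∑[ a < n ] (𝟙 (A a) * (H w * 𝟙 (w ⊆ᵇ N⁻ a)))
        ≡⟨ sum-cong-≗ (λ a → x∙yz≈y∙xz (𝟙 (A a)) (H w) _) ⟩
          ∑[ a < n ] (H w * (𝟙 (A a) * 𝟙 (w ⊆ᵇ N⁻ a)))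
        ≡⟨ sym (*-distribˡ-sum (H w) (λ a → 𝟙 (A a) * 𝟙 (w ⊆ᵇ N⁻ a))) ⟩
          H w * #dominated w
        ≡⟨ *-comm (H w) (#dominated w) ⟩
          #dominated w ^ suc t
        ∎

    #dominated≤size : ∀ w → #dominated w ≤ size A
    #dominated≤size w = sum-mono λ a →
      subst (_≤ 𝟙 (A a)) (𝟙-∧ (A a) (w ⊆ᵇ N⁻ a)) (𝟙-∧≤ˡ (A a) (w ⊆ᵇ N⁻ a))

    ∑tuples-size : ∀ t X → ∑tuples t size X ≡ ∑[ v < n ] (𝟙 (X v) * #dominated (v ∷ []) ^ t)
    ∑tuples-size t X = *-cancelˡ-≡ _ _ 2 (begin
        2 * ∑tuples t size X
      ≡⟨ sym (∑tuples-* t 2 size X) ⟩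
        ∑tuples t (λ Y → 2 * size Y) X
      ≡⟨ sym (∑tuples-cong t #greedy-one X) ⟩
        ∑tuples t (#greedy 1) X
      ≡⟨ ∑tuples-#greedy t 1 X ⟩
        ∑[ v < n ] (𝟙 (X v) * (d v + d v))
      ≡⟨ sum-cong-≗ (λ v → double (𝟙 (X v)) (d v)) ⟩
        ∑[ v < n ] (2 * (𝟙 (X v) * d v))
      ≡⟨ sym (*-distribˡ-sum 2 (λ v → 𝟙 (X v) * d v)) ⟩
        2 * ∑[ v < n ] (𝟙 (X v) * d v)
      ∎)
      where
      open ≡-Reasoning
      d : Fin n → ℕ
      d v = #dominated (v ∷ []) ^ t
      double : ∀ a x → a * (x + x) ≡ 2 * (a * x)
      double = solve-∀

    ∑tuples-tangent : ∀ j s t X →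
      suc j * s ^ j * ∑tuples t size X
        ≤ 2 ^ (suc j * suc j) * ∑tuples t (#greedy (suc j)) X
          + (suc j * s ^ j * slack (suc j) + j * s ^ suc j) * size A ^ t
    ∑tuples-tangent j s t X = begin
        c₁ * ∑tuples t size X
      ≡⟨ sym (∑tuples-* t c₁ size X) ⟩
        ∑tuples t (λ Y → c₁ * size Y) X
      ≤⟨ ∑tuples-mono t (tangent-bound j s) X ⟩
        ∑tuples t (λ Y → 2 ^ (k * k) * #greedy k Y + c₀) X
      ≡⟨ ∑tuples-+ t (λ Y → 2 ^ (k * k) * #greedy k Y) (λ _ → c₀) X ⟩
        ∑tuples t (λ Y → 2 ^ (k * k) * #greedy k Y) X + ∑tuples t (λ _ → c₀) X
      ≡⟨ cong₂ _+_ (∑tuples-* t (2 ^ (k * k)) (#greedy k) X) (∑tuples-const t c₀ X) ⟩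
        2 ^ (k * k) * ∑tuples t (#greedy k) X + c₀ * size A ^ t
      ∎
      where
      open ≤-Reasoning
      k = suc j
      c₁ = k * s ^ j
      c₀ = k * s ^ j * slack k + j * s ^ k

    ∑tuples-size-lower : ∀ t X → (∀ v → X v ≡ true → size A ≤ 20 * #dominated (v ∷ [])) →
                         size A ^ t * size X ≤ 20 ^ t * ∑tuples t size X
    ∑tuples-size-lower t X outdegree = begin
        size A ^ t * size X
      ≡⟨ *-comm (size A ^ t) (size X) ⟩
        size X * size A ^ t
      ≡⟨ *-distribʳ-sum (size A ^ t) (𝟙 ∘ X) ⟩
        ∑[ v < n ] (𝟙 (X v) * size A ^ t)
      ≤⟨ sum-mono (λ v → 𝟙*-mono (X v) (λ v∈X → ^-monoˡ-≤ t (outdegree v v∈X))) ⟩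
        ∑[ v < n ] (𝟙 (X v) * (20 * d v) ^ t)
      ≡⟨ sum-cong-≗ (λ v → trans (cong (𝟙 (X v) *_) (^-distribʳ-* 20 (d v) t))
                                 (x∙yz≈y∙xz (𝟙 (X v)) (20 ^ t) _)) ⟩
        ∑[ v < n ] (20 ^ t * (𝟙 (X v) * d v ^ t))
      ≡⟨ sym (*-distribˡ-sum (20 ^ t) (λ v → 𝟙 (X v) * d v ^ t)) ⟩
        20 ^ t * ∑[ v < n ] (𝟙 (X v) * d v ^ t)
      ≡⟨ cong (20 ^ t *_) (sym (∑tuples-size t X)) ⟩
        20 ^ t * ∑tuples t size X
      ∎
      where
      open ≤-Reasoning
      d : Fin n → ℕ
      d v = #dominated (v ∷ [])

    ∑tuples-size-≥ : ∀ t s X → (∀ v → X v ≡ true → size A ≤ 20 * #dominated (v ∷ [])) →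
                     20 ^ t * s ≤ size X → size A ^ t * s ≤ ∑tuples t size X
    ∑tuples-size-≥ t s X outdegree 20ᵗs≤X = *-cancelˡ-≤ (20 ^ t) {{m^n≢0 20 t}} (begin
        20 ^ t * (size A ^ t * s)
      ≡⟨ x∙yz≈y∙xz (20 ^ t) (size A ^ t) s ⟩
        size A ^ t * (20 ^ t * s)
      ≤⟨ *-monoʳ-≤ (size A ^ t) 20ᵗs≤X ⟩
        size A ^ t * size X
      ≤⟨ ∑tuples-size-lower t X outdegree ⟩
        20 ^ t * ∑tuples t size X
      ∎)
      where open ≤-Reasoning

    dense : ℕ → List (Fin n) → Bool
    dense K w = size A ≤ᵇ K * #dominated w

    #dense : ℕ → ℕ → VSet n → ℕ
    #dense K k X = ∑greedy k X (𝟙 ∘ dense K)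

    #dense-empty : size A ≡ 0 → ∀ K k X → #dense K k X ≡ #greedy k X
    #dense-empty A≡∅ K k X = ∑greedy-cong k {Z = X} (λ _ → refl) (λ w → cong (λ m → 𝟙 (m ≤ᵇ K * #dominated w)) A≡∅)

    #dominated^-split : ∀ K t w → K ^ t * #dominated w ^ t ≤ size A ^ t * (K ^ t * 𝟙 (dense K w) + 1)
    #dominated^-split K t w with dense K w in eq
    ... | true = begin
        K ^ t * #dominated w ^ t
      ≤⟨ *-monoʳ-≤ (K ^ t) (^-monoˡ-≤ t (#dominated≤size w)) ⟩
        K ^ t * size A ^ t
      ≤⟨ m≤m+n (K ^ t * size A ^ t) (size A ^ t) ⟩
        K ^ t * size A ^ t + size A ^ t
      ≡⟨ regroup (K ^ t) (size A ^ t) ⟩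
        size A ^ t * (K ^ t * 1 + 1)
      ∎
      where
      open ≤-Reasoning
      regroup : ∀ a m → a * m + m ≡ m * (a * 1 + 1)
      regroup = solve-∀
    ... | false = begin
        K ^ t * #dominated w ^ t
      ≡⟨ sym (^-distribʳ-* K (#dominated w) t) ⟩
        (K * #dominated w) ^ t
      ≤⟨ ^-monoˡ-≤ t (<⇒≤ (≰⇒> sparse)) ⟩
        size A ^ t
      ≡⟨ regroup (K ^ t) (size A ^ t) ⟩
        size A ^ t * (K ^ t * 0 + 1)
      ∎
      where
      open ≤-Reasoning
      sparse : ¬ (size A ≤ K * #dominated w)
      sparse le = subst Bool.T eq (≤⇒≤ᵇ le)
      regroup : ∀ a m → m ≡ m * (a * 0 + 1)
      regroup = solve-∀

    dense-split : ∀ K t k X → K ^ t * ∑greedy k X (λ w → #dominated w ^ t)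
                              ≤ size A ^ t * (K ^ t * #dense K k X + #greedy k X)
    dense-split K t k X = begin
        K ^ t * ∑greedy k X (λ w → #dominated w ^ t)
      ≡⟨ sym (∑greedy-* k X (K ^ t) _) ⟩
        ∑greedy k X (λ w → K ^ t * #dominated w ^ t)
      ≤⟨ ∑greedy-mono k X (λ {w} _ → #dominated^-split K t w) ⟩
        ∑greedy k X (λ w → size A ^ t * (K ^ t * 𝟙 (dense K w) + 1))
      ≡⟨ ∑greedy-* k X (size A ^ t) _ ⟩
        size A ^ t * ∑greedy k X (λ w → K ^ t * 𝟙 (dense K w) + 1)
      ≡⟨ cong (size A ^ t *_) (∑greedy-+ k X (λ w → K ^ t * 𝟙 (dense K w)) (λ _ → 1)) ⟩
        size A ^ t * (∑greedy k X (λ w → K ^ t * 𝟙 (dense K w)) + #greedy k X)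
      ≡⟨ cong (λ y → size A ^ t * (y + #greedy k X)) (∑greedy-* k X (K ^ t) (𝟙 ∘ dense K)) ⟩
        size A ^ t * (K ^ t * #dense K k X + #greedy k X)
      ∎
      where open ≤-Reasoning

    many-dense-greedy : ∀ j t s K X →
      (∀ v → X v ≡ true → size A ≤ 20 * #dominated (v ∷ [])) → 1 ≤ size A →
      20 ^ t * s ≤ size X → 2 * suc j * slack (suc j) ≤ s →
      K ^ t * (s * s ^ j) ≤ 2 * 2 ^ (suc j * suc j) * (K ^ t * #dense K (suc j) X + #greedy (suc j) X)
    many-dense-greedy j t s K X outdegree A≢∅ 20ᵗs≤X spread = *-cancelˡ-≤ M (begin
        M * (K ^ t * (s * P))
      ≡⟨ x∙yz≈y∙xz M (K ^ t) (s * P) ⟩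
        K ^ t * (M * (s * P))
      ≡⟨ cong (K ^ t *_) (*-comm M (s * P)) ⟩
        K ^ t * (s * P * M)
      ≤⟨ *-monoʳ-≤ (K ^ t) (drc-arithmetic j tangent spread) ⟩
        K ^ t * (2 * (2 ^ (k * k) * W))
      ≡⟨ cong (λ y → K ^ t * (2 * (2 ^ (k * k) * y))) (∑tuples-#greedy t k X) ⟩
        K ^ t * (2 * (2 ^ (k * k) * ∑greedy k X (λ w → #dominated w ^ t)))
      ≡⟨ regroup (K ^ t) (2 ^ (k * k)) _ ⟩
        2 * 2 ^ (k * k) * (K ^ t * ∑greedy k X (λ w → #dominated w ^ t))
      ≤⟨ *-monoʳ-≤ (2 * 2 ^ (k * k)) (dense-split K t k X) ⟩
        2 * 2 ^ (k * k) * (M * (K ^ t * #dense K k X + #greedy k X))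
      ≡⟨ x∙yz≈y∙xz (2 * 2 ^ (k * k)) M _ ⟩
        M * (2 * 2 ^ (k * k) * (K ^ t * #dense K k X + #greedy k X))
      ∎)
      where
      open ≤-Reasoning
      k = suc j
      P = s ^ j
      M = size A ^ t
      W = ∑tuples t (#greedy k) X
      instance
        M≢0 : NonZero M
        M≢0 = >-nonZero (subst (_≤ M) (^-zeroˡ t) (^-monoˡ-≤ t A≢∅))
      tangent : k * P * (M * s) ≤ 2 ^ (k * k) * W + (k * P * slack k + j * (s * P)) * M
      tangent = ≤-trans (*-monoʳ-≤ (k * P) (∑tuples-size-≥ t s X outdegree 20ᵗs≤X)) (∑tuples-tangent j s t X)
      regroup : ∀ a b c → a * (2 * (b * c)) ≡ 2 * b * (a * c)
      regroup = solve-∀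

  transitiveB-complete : ∀ S → TransitiveOn Arc (lookup S) → transitiveB T S ≡ true
  transitiveB-complete S tr =
    allIn-complete S λ x∈ → allIn-complete S λ y∈ → allIn-complete S λ z∈ → closed x∈ y∈ z∈
    where
    closed : ∀ {x y z} → lookup S x ≡ true → lookup S y ≡ true → lookup S z ≡ true →
             (not (E T x y ∧ E T y z) ∨ E T x z) ≡ true
    closed {x} {y} {z} x∈ y∈ z∈ with E T x y in x→y | E T y z in y→z
    ... | true  | true  = tr x∈ y∈ z∈ x→y y→z
    ... | true  | false = refl
    ... | false | _     = refl

  transitiveB-sound : ∀ S → transitiveB T S ≡ true → TransitiveOn Arc (lookup S)
  transitiveB-sound S tr {x} {y} {z} x∈ y∈ z∈ x→y y→z
    with allIn-sound S (allIn-sound S (allIn-sound S tr x∈) y∈) z∈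
  ... | closed rewrite x→y | y→z = closed

  module _ (A : Subset n) where

    isHeadB-toSubset : ∀ {k Z w} → Greedy k Z w →
                       isHeadB T k A (toSubset w) ≡ dense (lookup A) (2 ^ (6 * k)) w
    isHeadB-toSubset {k} {w = w} greedy =
      cong₂ _∧_ transitive (cong₂ _∧_ size≡k (cong₂ (λ a c → a ≤ᵇ 2 ^ (6 * k) * c) (∣∣≡∑𝟙 A) common))
      where
      transitive : transitiveB T (toSubset w) ≡ true
      transitive = transitiveB-complete (toSubset w) λ x∈ y∈ z∈ →
        Greedy-transitive greedy (∈-toSubset x∈) (∈-toSubset y∈) (∈-toSubset z∈)
        where
        ∈-toSubset : ∀ {u} → lookup (toSubset w) u ≡ true → u ∈ᵇ w ≡ true
        ∈-toSubset {u} = trans (sym (lookup∘tabulate (_∈ᵇ w) u))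
      size≡k : (∣ toSubset w ∣ ≡ᵇ k) ≡ true
      size≡k = Equivalence.to T-≡ (≡⇒≡ᵇ _ k (trans (∣tabulate∣ (_∈ᵇ w)) (Greedy-size greedy)))
      common : ∣ commonOut T (toSubset w) A ∣ ≡ #dominated (lookup A) w
      common = trans (∣tabulate∣ (λ a → lookup A a ∧ allIn (toSubset w) (N⁻ a))) (sum-cong-≗ λ a →
        trans (𝟙-∧ (lookup A a) _) (cong (λ b → 𝟙 (lookup A a) * 𝟙 b) (allIn-toSubset w (N⁻ a))))

    dense-covered : ∀ k (X : Subset n) {w} → Greedy k (lookup X) w →
                    𝟙 (dense (lookup A) (2 ^ (6 * k)) w)
                      ≤ ∑ˡ (allSubsets n) (λ H → 𝟙 (subB H X ∧ isHeadB T k A H) * 𝟙 (w ⊆ᵇ lookup H))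
    dense-covered k X {w} greedy =
      subst (_≤ ∑ˡ (allSubsets n) weight) toSubset-weight (∑ˡ-∈ weight (∈-allSubsets (toSubset w)))
      where
      weight : Subset n → ℕ
      weight H = 𝟙 (subB H X ∧ isHeadB T k A H) * 𝟙 (w ⊆ᵇ lookup H)
      w⊆toSubset : w ⊆ᵇ lookup (toSubset w) ≡ true
      w⊆toSubset = ⊆ᵇ-complete w (λ {u} u∈w → trans (lookup∘tabulate (_∈ᵇ w) u) u∈w)
      toSubset-weight : weight (toSubset w) ≡ 𝟙 (dense (lookup A) (2 ^ (6 * k)) w)
      toSubset-weight rewrite allIn-toSubset w (lookup X) | Greedy-⊆ᵇ greedy | isHeadB-toSubset greedy
                            | w⊆toSubset = *-identityʳ _

  isHeadB⇒size : ∀ k A H → isHeadB T k A H ≡ true → ∣ H ∣ ≡ k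
  isHeadB⇒size k A H head = ≡ᵇ⇒≡ ∣ H ∣ k (Equivalence.from T-≡ (∧-conicalˡ _ _ (∧-conicalʳ (transitiveB T H) _ head)))

  #greedy-∩-≤ : ∀ k Z (H : Subset n) → ∣ H ∣ ≡ k → #greedy k (Z ∩ lookup H) ≤ 2 ^ k * k ^ k
  #greedy-∩-≤ k Z H ∣H∣≡k = ≤-trans (#greedy-upper k (Z ∩ lookup H)) (*-monoʳ-≤ (2 ^ k) (^-monoˡ-≤ k (begin
      size (Z ∩ lookup H)
    ≤⟨ size-∩ʳ Z (lookup H) ⟩
      size (lookup H)
    ≡⟨ trans (sym (∣∣≡∑𝟙 H)) ∣H∣≡k ⟩
      k
    ∎)))
    where open ≤-Reasoning

  #dense≤#heads : ∀ (A : Subset n) k (X : Subset n) →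
                  #dense (lookup A) (2 ^ (6 * k)) k (lookup X) ≤ 2 ^ k * k ^ k * #heads T k A X
  #dense≤#heads A k X = begin
      ∑greedy k (lookup X) (𝟙 ∘ dense (lookup A) (2 ^ (6 * k)))
    ≤⟨ ∑greedy-mono k (lookup X) (dense-covered A k X) ⟩
      ∑greedy k (lookup X) (λ w → ∑ˡ L (λ H → c H * 𝟙 (w ⊆ᵇ lookup H)))
    ≡⟨ ∑greedy-∑ˡ k (lookup X) L (λ H w → c H * 𝟙 (w ⊆ᵇ lookup H)) ⟩
      ∑ˡ L (λ H → ∑greedy k (lookup X) (λ w → c H * 𝟙 (w ⊆ᵇ lookup H)))
    ≤⟨ ∑ˡ-mono L per-head ⟩
      ∑ˡ L (λ H → c H * (2 ^ k * k ^ k))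
    ≡⟨ ∑ˡ-*ʳ L c (2 ^ k * k ^ k) ⟩
      ∑ˡ L c * (2 ^ k * k ^ k)
    ≡⟨ cong (_* (2 ^ k * k ^ k)) (sym (length-filterᵇ head⊆X L)) ⟩
      #heads T k A X * (2 ^ k * k ^ k)
    ≡⟨ *-comm (#heads T k A X) _ ⟩
      2 ^ k * k ^ k * #heads T k A X
    ∎
    where
    open ≤-Reasoning
    L = allSubsets n
    head⊆X : Subset n → Bool
    head⊆X H = subB H X ∧ isHeadB T k A H
    c : Subset n → ℕ
    c = 𝟙 ∘ head⊆X
    per-head : ∀ H → ∑greedy k (lookup X) (λ w → c H * 𝟙 (w ⊆ᵇ lookup H)) ≤ c H * (2 ^ k * k ^ k)
    per-head H = begin
        ∑greedy k (lookup X) (λ w → c H * 𝟙 (w ⊆ᵇ lookup H))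
      ≡⟨ ∑greedy-* k (lookup X) (c H) _ ⟩
        c H * ∑greedy k (lookup X) (λ w → 𝟙 (w ⊆ᵇ lookup H))
      ≡⟨ cong (c H *_) (#greedy-restrict k (lookup X) (lookup H)) ⟩
        c H * #greedy k (lookup X ∩ lookup H)
      ≤⟨ 𝟙*-mono (head⊆X H) (λ head → #greedy-∩-≤ k (lookup X) H
                                 (isHeadB⇒size k A H (∧-conicalʳ (subB H X) _ head))) ⟩
        c H * (2 ^ k * k ^ k)
      ∎

n<2^n : ∀ n → n < 2 ^ n
n<2^n zero    = s≤s z≤n
n<2^n (suc n) = begin-strict
    suc n
  <⟨ s≤s (n<2^n n) ⟩
    suc (2 ^ n)
  ≤⟨ +-monoˡ-≤ (2 ^ n) (^-monoʳ-≤ 2 {0} {n} z≤n) ⟩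
    2 ^ n + 2 ^ n
  ≡⟨ cong (2 ^ n +_) (sym (+-identityʳ (2 ^ n))) ⟩
    2 ^ suc n
  ∎
  where open ≤-Reasoning

slack<2^ : ∀ k → slack k < 2 ^ k
slack<2^ zero    = ≤-refl
slack<2^ (suc k) = subst (_≤ 2 * 2 ^ k) (double-suc (slack k)) (*-monoʳ-≤ 2 (slack<2^ k))
  where
  double-suc : ∀ d → 2 * suc d ≡ suc (suc (2 * d))
  double-suc = solve-∀

k^k≤2^k² : ∀ k → k ^ k ≤ 2 ^ (k * k)
k^k≤2^k² k = subst (k ^ k ≤_) (^-*-assoc 2 k k) (^-monoˡ-≤ k (<⇒≤ (n<2^n k)))

20^3k≤2^13k : ∀ k → 20 ^ (3 * k) ≤ 2 ^ (13 * k)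
20^3k≤2^13k k = subst₂ _≤_ (^-*-assoc 20 3 k) (^-*-assoc 2 13 k) (^-monoˡ-≤ k (≤ᵇ⇒≤ 8000 8192 _))

nCk≤n^k : ∀ n k → n C k ≤ n ^ k
nCk≤n^k n       zero    = ≤-refl
nCk≤n^k zero    (suc k) = z≤n
nCk≤n^k (suc n) (suc k) = begin
    suc n C suc k
  ≡⟨ sym (nCk+nC[k+1]≡[n+1]C[k+1] n k) ⟩
    n C k + n C suc k
  ≤⟨ +-mono-≤ (nCk≤n^k n k) (nCk≤n^k n (suc k)) ⟩
    n ^ k + n * n ^ k
  ≤⟨ +-mono-≤ (^-monoˡ-≤ k (n≤1+n n)) (*-monoʳ-≤ n (^-monoˡ-≤ k (n≤1+n n))) ⟩
    suc n ^ suc k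
  ∎
  where open ≤-Reasoning

nCk>0 : ∀ n k → k ≤ n → 0 < n C k
nCk>0 n       zero    _         = s≤s z≤n
nCk>0 (suc n) (suc k) (s≤s k≤n) =
  ≤-trans (nCk>0 n k k≤n) (subst (n C k ≤_) (nCk+nC[k+1]≡[n+1]C[k+1] n k) (m≤m+n _ _))

≤-/ : ∀ a N d .{{_ : NonZero d}} → d * a ≤ N → a ≤ N / d
≤-/ a N d da≤N = subst (_≤ N / d) (m*n/n≡m a d) (/-monoˡ-≤ d (subst (_≤ N) (*-comm d a) da≤N))

*-/-≤ : ∀ N d .{{_ : NonZero d}} → d * (N / d) ≤ N
*-/-≤ N d = subst (_≤ N) (*-comm (N / d) d) (m/n*n≤m N d)

≤-2*-/ : ∀ N d .{{_ : NonZero d}} → 1 ≤ N / d → N ≤ 2 * (d * (N / d))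
≤-2*-/ N d 1≤N/d = begin
    N
  ≡⟨ m≡m%n+[m/n]*n N d ⟩
    N % d + N / d * d
  ≤⟨ +-monoˡ-≤ (N / d * d) (<⇒≤ (m%n<n N d)) ⟩
    d + N / d * d
  ≤⟨ +-monoˡ-≤ (N / d * d) (subst (_≤ d * (N / d)) (*-identityʳ d) (*-monoʳ-≤ d 1≤N/d)) ⟩
    d * (N / d) + N / d * d
  ≡⟨ twice d (N / d) ⟩
    2 * (d * (N / d))
  ∎
  where
  open ≤-Reasoning
  twice : ∀ d q → d * q + q * d ≡ 2 * (d * q)
  twice = solve-∀

N^k-from-lower : ∀ j {N D G} → 2 * D ≤ N → (N ∸ D) ^ suc j ≤ 2 ^ (suc j * suc j) * G →
                 N ^ suc j ≤ 2 ^ (14 * (suc j * suc j) + suc j + 2) * G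
N^k-from-lower j {N} {D} {G} 2D≤N lower = begin
    N ^ k
  ≤⟨ ^-monoˡ-≤ k N≤2[N∸D] ⟩
    (2 * (N ∸ D)) ^ k
  ≡⟨ ^-distribʳ-* 2 (N ∸ D) k ⟩
    2 ^ k * (N ∸ D) ^ k
  ≤⟨ *-monoʳ-≤ (2 ^ k) lower ⟩
    2 ^ k * (2 ^ (k * k) * G)
  ≡⟨ trans (sym (*-assoc (2 ^ k) _ G)) (cong (_* G) (sym (^-distribˡ-+-* 2 k (k * k)))) ⟩
    2 ^ (k + k * k) * G
  ≤⟨ *-monoˡ-≤ G (^-monoʳ-≤ 2 (subst (k + k * k ≤_) (exponents j) (m≤m+n _ _))) ⟩
    2 ^ (14 * (k * k) + k + 2) * G
  ∎
  where
  open ≤-Reasoning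
  k = suc j
  exponents : ∀ j → (suc j + suc j * suc j) + (13 * (suc j * suc j) + 2) ≡ 14 * (suc j * suc j) + suc j + 2
  exponents = solve-∀
  N≤2[N∸D] : N ≤ 2 * (N ∸ D)
  N≤2[N∸D] = begin
      N
    ≤⟨ m≤n+m∸n N D ⟩
      D + (N ∸ D)
    ≤⟨ +-monoˡ-≤ (N ∸ D) (subst (_≤ N ∸ D) (m+n∸n≡m D D) (∸-monoˡ-≤ D (subst (_≤ N) (cong (D +_) (+-identityʳ D)) 2D≤N))) ⟩
      (N ∸ D) + (N ∸ D)
    ≡⟨ cong ((N ∸ D) +_) (sym (+-identityʳ (N ∸ D))) ⟩
      2 * (N ∸ D)
    ∎

2*slack≤ : ∀ j {N} → 2 ^ (30 * suc j) ≤ N → 2 * slack (suc j) ≤ N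
2*slack≤ j big = ≤-trans (*-monoʳ-≤ 2 (<⇒≤ (slack<2^ (suc j))))
                   (≤-trans (^-monoʳ-≤ 2 (subst (1 + suc j ≤_) (exponent j) (m≤m+n _ _))) big)
  where
  exponent : ∀ j → 1 + suc j + (29 * j + 28) ≡ 30 * suc j
  exponent = solve-∀

spread≤ : ∀ j {N} → 2 ^ (30 * suc j) ≤ N → 20 ^ (3 * suc j) * (2 * suc j * slack (suc j)) ≤ N
spread≤ j {N} big = begin
    20 ^ (3 * k) * (2 * k * slack k)
  ≤⟨ *-mono-≤ (20^3k≤2^13k k) (*-mono-≤ (*-monoʳ-≤ 2 (<⇒≤ (n<2^n k))) (<⇒≤ (slack<2^ k))) ⟩
    2 ^ (13 * k) * (2 * 2 ^ k * 2 ^ k)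
  ≡⟨ cong (2 ^ (13 * k) *_) (sym (^-distribˡ-+-* 2 (1 + k) k)) ⟩
    2 ^ (13 * k) * 2 ^ (1 + k + k)
  ≡⟨ sym (^-distribˡ-+-* 2 (13 * k) (1 + k + k)) ⟩
    2 ^ (13 * k + (1 + k + k))
  ≤⟨ ^-monoʳ-≤ 2 (subst (13 * k + (1 + k + k) ≤_) (exponent j) (m≤m+n _ _)) ⟩
    2 ^ (30 * k)
  ≤⟨ big ⟩
    N
  ∎
  where
  open ≤-Reasoning
  k = suc j
  exponent : ∀ j → 13 * suc j + (1 + suc j + suc j) + (15 * j + 14) ≡ 30 * suc j
  exponent = solve-∀

absorb-minor : ∀ K {x a G F} .{{_ : NonZero K}} → K * x ≤ a * (K * G + F) → 2 * (a * F) ≤ K * x →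
               x ≤ 2 * a * G
absorb-minor K {x} {a} {G} {F} major minor = *-cancelˡ-≤ K (begin
    K * x
  ≤⟨ ≤-absorb-half {b = a * F} (subst (K * x ≤_) (*-distribˡ-+ a (K * G) F) major) minor ⟩
    2 * (a * (K * G))
  ≡⟨ regroup a K G ⟩
    K * (2 * a * G)
  ∎)
  where
  open ≤-Reasoning
  regroup : ∀ a K G → 2 * (a * (K * G)) ≡ K * (2 * a * G)
  regroup = solve-∀

^-scaled : ∀ j {N s} → N ≤ 2 * (20 ^ (3 * suc j) * s) →
           N ^ suc j ≤ 2 ^ (suc j + 13 * (suc j * suc j)) * (s * s ^ j)
^-scaled j {N} {s} N≤ = begin
    N ^ k
  ≤⟨ ^-monoˡ-≤ k N≤ ⟩
    (2 * (20 ^ (3 * k) * s)) ^ k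
  ≡⟨ trans (^-distribʳ-* 2 (20 ^ (3 * k) * s) k) (cong (2 ^ k *_) (^-distribʳ-* (20 ^ (3 * k)) s k)) ⟩
    2 ^ k * ((20 ^ (3 * k)) ^ k * s ^ k)
  ≤⟨ *-monoʳ-≤ (2 ^ k) (*-monoˡ-≤ (s ^ k) (^-monoˡ-≤ k (20^3k≤2^13k k))) ⟩
    2 ^ k * ((2 ^ (13 * k)) ^ k * s ^ k)
  ≡⟨ cong (λ x → 2 ^ k * (x * s ^ k)) (trans (^-*-assoc 2 (13 * k) k) (cong (2 ^_) (*-assoc 13 k k))) ⟩
    2 ^ k * (2 ^ (13 * (k * k)) * s ^ k)
  ≡⟨ trans (sym (*-assoc (2 ^ k) _ (s ^ k))) (cong (_* s ^ k) (sym (^-distribˡ-+-* 2 k (13 * (k * k))))) ⟩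
    2 ^ (k + 13 * (k * k)) * s ^ k
  ∎
  where
  open ≤-Reasoning
  k = suc j

N^k-from-drc : ∀ j {N s G F} → let k = suc j in
  N ≤ 2 * (20 ^ (3 * k) * s) →
  2 ^ (18 * (k * k)) * (s * s ^ j) ≤ 2 * 2 ^ (k * k) * (2 ^ (18 * (k * k)) * G + F) →
  F ≤ 2 ^ k * N ^ k →
  N ^ k ≤ 2 ^ (14 * (k * k) + k + 2) * G
N^k-from-drc j {N} {s} {G} {F} N≤ drc F≤ = begin
    N ^ k
  ≤⟨ ^-scaled j N≤ ⟩
    2 ^ (k + 13 * k²) * sᵏ
  ≤⟨ *-monoʳ-≤ (2 ^ (k + 13 * k²)) (absorb-minor (2 ^ (18 * k²)) {a = 2 * 2 ^ k²} {{m^n≢0 2 (18 * k²)}} drc F-minor) ⟩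
    2 ^ (k + 13 * k²) * (2 * (2 * 2 ^ k²) * G)
  ≡⟨ cong (λ c → 2 ^ (k + 13 * k²) * (c * G)) (four (2 ^ k²)) ⟩
    2 ^ (k + 13 * k²) * (2 ^ 2 * 2 ^ k² * G)
  ≡⟨ trans (sym (*-assoc (2 ^ (k + 13 * k²)) _ G)) (cong (_* G) (2^-sum₃ (k + 13 * k²) 2 k²)) ⟩
    2 ^ (k + 13 * k² + 2 + k²) * G
  ≡⟨ cong (λ e → 2 ^ e * G) (exponents₁ j) ⟩
    2 ^ (14 * k² + k + 2) * G
  ∎
  where
  open ≤-Reasoning
  k = suc j
  k² = k * k
  sᵏ = s * s ^ j
  four : ∀ x → 2 * (2 * x) ≡ 2 ^ 2 * x
  four = solve-∀
  2^-sum₃ : ∀ a b c → 2 ^ a * (2 ^ b * 2 ^ c) ≡ 2 ^ (a + b + c)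
  2^-sum₃ a b c = sym (trans (^-distribˡ-+-* 2 (a + b) c)
                    (trans (cong (_* 2 ^ c) (^-distribˡ-+-* 2 a b)) (*-assoc (2 ^ a) (2 ^ b) (2 ^ c))))
  exponents₁ : ∀ j → suc j + 13 * (suc j * suc j) + 2 + suc j * suc j ≡ 14 * (suc j * suc j) + suc j + 2
  exponents₁ = solve-∀
  F-minor : 2 * (2 * 2 ^ k² * F) ≤ 2 ^ (18 * k²) * sᵏ
  F-minor = begin
      2 * (2 * 2 ^ k² * F)
    ≤⟨ *-monoʳ-≤ 2 (*-monoʳ-≤ (2 * 2 ^ k²) (≤-trans F≤ (*-monoʳ-≤ (2 ^ k) (^-scaled j N≤)))) ⟩
      2 * (2 * 2 ^ k² * (2 ^ k * (2 ^ (k + 13 * k²) * sᵏ)))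
    ≡⟨ regroup (2 ^ k²) (2 ^ k) (2 ^ (k + 13 * k²)) sᵏ ⟩
      2 ^ 2 * (2 ^ k² * (2 ^ k * 2 ^ (k + 13 * k²))) * sᵏ
    ≡⟨ cong (λ x → 2 ^ 2 * x * sᵏ) (2^-sum₃ k² k (k + 13 * k²)) ⟩
      2 ^ 2 * 2 ^ (k² + k + (k + 13 * k²)) * sᵏ
    ≡⟨ cong (_* sᵏ) (sym (^-distribˡ-+-* 2 2 (k² + k + (k + 13 * k²)))) ⟩
      2 ^ (2 + (k² + k + (k + 13 * k²))) * sᵏ
    ≤⟨ *-monoˡ-≤ sᵏ (^-monoʳ-≤ 2 (subst (2 + (k² + k + (k + 13 * k²)) ≤_) (exponents₂ j) (m≤m+n _ _))) ⟩
      2 ^ (18 * k²) * sᵏ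
    ∎
    where
    regroup : ∀ a b c x → 2 * (2 * a * (b * (c * x))) ≡ 2 ^ 2 * (a * (b * c)) * x
    regroup = solve-∀
    exponents₂ : ∀ j → 2 + (suc j * suc j + suc j + (suc j + 13 * (suc j * suc j))) + (4 * (j * j) + 6 * j)
                        ≡ 18 * (suc j * suc j)
    exponents₂ = solve-∀

outdegree→#dominated : ∀ {n} (T : Tournament n) (A X : Subset n) →
                       (∀ v → v ∈ X → ∣ A ∣ ≤ 20 * ∣ outIn T v A ∣) →
                       ∀ v → lookup X v ≡ true → size (lookup A) ≤ 20 * #dominated T (lookup A) (v ∷ [])
outdegree→#dominated T A X outdegree v v∈X =
  subst₂ (λ a d → a ≤ 20 * d) (∣∣≡∑𝟙 A) outIn≡#dominated (outdegree v (lookup⇒[]= v X v∈X))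
  where
  outIn≡#dominated : ∣ outIn T v A ∣ ≡ #dominated T (lookup A) (v ∷ [])
  outIn≡#dominated = trans (∣tabulate∣ (λ a → lookup A a ∧ E T v a)) (sum-cong-≗ λ a →
    trans (𝟙-∧ (lookup A a) (E T v a)) (cong (λ b → 𝟙 (lookup A a) * 𝟙 b) (sym (∧-identityʳ (E T v a)))))

N^k≤#dense : ∀ j {n} (T : Tournament n) (A X : Subset n) → 2 ^ (30 * suc j) ≤ ∣ X ∣ →
             (∀ v → v ∈ X → ∣ A ∣ ≤ 20 * ∣ outIn T v A ∣) →
             ∣ X ∣ ^ suc j ≤ 2 ^ (14 * (suc j * suc j) + suc j + 2) * #dense T (lookup A) (2 ^ (6 * suc j)) (suc j) (lookup X)
-- For empty A every sequence is dense; otherwise |A|ᵗ can be cancelled in the averaging.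
N^k≤#dense j T A X big outdegree with size (lookup A) ≟ 0
... | yes A≡∅ = N^k-from-lower j {D = slack (suc j)} (2*slack≤ j big)
                  (subst₂ (λ N F → (N ∸ slack (suc j)) ^ suc j ≤ 2 ^ (suc j * suc j) * F)
                     (sym (∣∣≡∑𝟙 X)) (sym (#dense-empty T (lookup A) A≡∅ (2 ^ (6 * suc j)) (suc j) (lookup X)))
                     (#greedy-lower T (suc j) (lookup X)))
... | no A≢∅ = N^k-from-drc j (≤-2*-/ N (20 ^ t) (≤-trans (s≤s z≤n) spread)) drc
                 (subst (λ m → #greedy T k (lookup X) ≤ 2 ^ k * m ^ k) (sym (∣∣≡∑𝟙 X)) (#greedy-upper T k (lookup X)))
  where
  k = suc j
  t = 3 * k
  N = ∣ X ∣
  instance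
    20ᵗ≢0 : NonZero (20 ^ t)
    20ᵗ≢0 = m^n≢0 20 t
  s = N / 20 ^ t
  spread : 2 * k * slack k ≤ s
  spread = ≤-/ (2 * k * slack k) N (20 ^ t) (spread≤ j big)
  exponent : ∀ j → 6 * suc j * (3 * suc j) ≡ 18 * (suc j * suc j)
  exponent = solve-∀
  drc : 2 ^ (18 * (k * k)) * (s * s ^ j)
        ≤ 2 * 2 ^ (k * k) * (2 ^ (18 * (k * k)) * #dense T (lookup A) (2 ^ (6 * k)) k (lookup X) + #greedy T k (lookup X))
  drc = subst (λ Kᵗ → Kᵗ * (s * s ^ j) ≤ 2 * 2 ^ (k * k) * (Kᵗ * #dense T (lookup A) (2 ^ (6 * k)) k (lookup X) + #greedy T k (lookup X)))
          (trans (^-*-assoc 2 (6 * k) t) (cong (2 ^_) (exponent j)))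
          (many-dense-greedy T (lookup A) j t s (2 ^ (6 * k)) (lookup X) (outdegree→#dominated T A X outdegree)
             (n≢0⇒n>0 A≢∅) (subst (20 ^ t * s ≤_) (∣∣≡∑𝟙 X) (*-/-≤ N (20 ^ t))) spread)

-- Counting heads, and tails in the opposite tournament

heads-count : ∀ j {n} (T : Tournament n) (A X : Subset n) → 2 ^ (30 * suc j) ≤ ∣ X ∣ →
              (∀ v → v ∈ X → ∣ A ∣ ≤ 20 * ∣ outIn T v A ∣) →
              ∣ X ∣ C suc j ≤ 2 ^ (30 * (suc j * suc j)) * #heads T (suc j) A X
heads-count j T A X big outdegree = begin
    ∣ X ∣ C k
  ≤⟨ nCk≤n^k ∣ X ∣ k ⟩
    ∣ X ∣ ^ k
  ≤⟨ N^k≤#dense j T A X big outdegree ⟩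
    2 ^ e * #dense T (lookup A) (2 ^ (6 * k)) k (lookup X)
  ≤⟨ *-monoʳ-≤ (2 ^ e) (#dense≤#heads T A k X) ⟩
    2 ^ e * (2 ^ k * k ^ k * H)
  ≤⟨ *-monoʳ-≤ (2 ^ e) (*-monoˡ-≤ H (*-monoʳ-≤ (2 ^ k) (k^k≤2^k² k))) ⟩
    2 ^ e * (2 ^ k * 2 ^ (k * k) * H)
  ≡⟨ cong (λ x → 2 ^ e * (x * H)) (sym (^-distribˡ-+-* 2 k (k * k))) ⟩
    2 ^ e * (2 ^ (k + k * k) * H)
  ≡⟨ trans (sym (*-assoc (2 ^ e) _ H)) (cong (_* H) (sym (^-distribˡ-+-* 2 e (k + k * k)))) ⟩
    2 ^ (e + (k + k * k)) * H
  ≤⟨ *-monoˡ-≤ H (^-monoʳ-≤ 2 (subst (e + (k + k * k) ≤_) (exponent j) (m≤m+n _ _))) ⟩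
    2 ^ (30 * (k * k)) * H
  ∎
  where
  open ≤-Reasoning
  k = suc j
  e = 14 * (k * k) + k + 2
  H = #heads T k A X
  exponent : ∀ j → 14 * (suc j * suc j) + suc j + 2 + (suc j + suc j * suc j) + (15 * (j * j) + 28 * j + 11)
                   ≡ 30 * (suc j * suc j)
  exponent = solve-∀

opposite : ∀ {n} → Tournament n → Tournament n
opposite T = record { E = flip (E T) ; irrefl = irrefl T ; tourn = λ u v u≢v → tourn T v u (u≢v ∘ sym) }

transitiveB-opposite : ∀ {n} (T : Tournament n) S → transitiveB (opposite T) S ≡ transitiveB T S
transitiveB-opposite T S = ⇔→≡ {z = true} (mk⇔
  (λ tr → transitiveB-complete T S
             (TransitiveOn-flip {R = Arc (opposite T)} {lookup S} (transitiveB-sound (opposite T) S tr)))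
  (λ tr → transitiveB-complete (opposite T) S
             (TransitiveOn-flip {R = Arc T} {lookup S} (transitiveB-sound T S tr))))

isHeadB-opposite : ∀ {n} (T : Tournament n) k A S → isHeadB (opposite T) k A S ≡ isTailB T k A S
isHeadB-opposite T k A S =
  cong (_∧ ((∣ S ∣ ≡ᵇ k) ∧ (∣ A ∣ ≤ᵇ 2 ^ (6 * k) * ∣ commonIn T S A ∣))) (transitiveB-opposite T S)

filterᵇ-cong : ∀ {a} {B : Set a} {p q : B → Bool} → (∀ x → p x ≡ q x) → ∀ xs → filterᵇ p xs ≡ filterᵇ q xs
filterᵇ-cong p≗q []       = refl
filterᵇ-cong {p = p} {q} p≗q (x ∷ xs) with p x | q x | p≗q x
... | true  | .true  | refl = cong (x ∷_) (filterᵇ-cong p≗q xs)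
... | false | .false | refl = filterᵇ-cong p≗q xs

#heads-opposite : ∀ {n} (T : Tournament n) k A X → #heads (opposite T) k A X ≡ #tails T k A X
#heads-opposite {n} T k A X =
  cong length (filterᵇ-cong (λ S → cong (subB S X ∧_) (isHeadB-opposite T k A S)) (allSubsets n))

filterᵇ-witness : ∀ {a} {B : Set a} (p : B → Bool) xs → 0 < length (filterᵇ p xs) → ∃[ x ] p x ≡ true
filterᵇ-witness p (x ∷ xs) nonempty with p x in px
... | true  = x , px
... | false = filterᵇ-witness p xs nonempty

subB-sound : ∀ {n} (H S : Subset n) → subB H S ≡ true → H ⊆ S
subB-sound H S H⊆S {x} x∈H = lookup⇒[]= x S (allIn-sound H H⊆S ([]=⇒lookup x∈H))

head-exists : ∀ j {n} (T : Tournament n) (A S : Subset n) → 2 ^ (30 * suc j) ≤ ∣ S ∣ →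
              (∀ v → v ∈ S → ∣ A ∣ ≤ 20 * ∣ outIn T v A ∣) →
              ∃[ H ] (H ⊆ S × IsHead T (suc j) A H)
head-exists j {n} T A S big outdegree =
  good→head (filterᵇ-witness (λ H → subB H S ∧ isHeadB T (suc j) A H) (allSubsets n) heads>0)
  where
  good→head : ∃[ H ] (subB H S ∧ isHeadB T (suc j) A H) ≡ true → ∃[ H ] (H ⊆ S × IsHead T (suc j) A H)
  good→head (H , good) = H , subB-sound H S (∧-conicalˡ _ _ good) , Equivalence.from T-≡ (∧-conicalʳ (subB H S) _ good)
  S≥k : suc j ≤ ∣ S ∣
  S≥k = ≤-trans (<⇒≤ (n<2^n (suc j))) (≤-trans (^-monoʳ-≤ 2 (m≤n*m (suc j) 30)) big)
  heads>0 : 0 < #heads T (suc j) A S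
  heads>0 = n≢0⇒n>0 λ no-heads → <-irrefl refl (begin-strict
      0
    <⟨ nCk>0 ∣ S ∣ (suc j) S≥k ⟩
      ∣ S ∣ C suc j
    ≤⟨ heads-count j T A S big outdegree ⟩
      2 ^ (30 * (suc j * suc j)) * #heads T (suc j) A S
    ≡⟨ cong (2 ^ (30 * (suc j * suc j)) *_) no-heads ⟩
      2 ^ (30 * (suc j * suc j)) * 0
    ≡⟨ *-zeroʳ (2 ^ (30 * (suc j * suc j))) ⟩
      0
    ∎)
    where open ≤-Reasoning

lemma2p8 : (k : ℕ) → 1 ≤ k → (n : ℕ) → (T : Tournament n) → (A : Subset n) →
    ((S : Subset n) → 2 ^ (30 * k) ≤ ∣ S ∣ →
      (∀ v → v ∈ S → ∣ A ∣ ≤ 20 * ∣ outIn T v A ∣) →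
      ∃[ H ] (H ⊆ S × IsHead T k A H))
    × ((S : Subset n) → 2 ^ (30 * k) ≤ ∣ S ∣ →
      (∀ v → v ∈ S → ∣ A ∣ ≤ 20 * ∣ inIn T v A ∣) →
      ∃[ H ] (H ⊆ S × IsTail T k A H))
    × ((X : Subset n) → 2 ^ (30 * k) ≤ ∣ X ∣ →
      (∀ v → v ∈ X → ∣ A ∣ ≤ 20 * ∣ outIn T v A ∣) →
      ∣ X ∣ C k ≤ 2 ^ (30 * (k * k)) * #heads T k A X)
    × ((X : Subset n) → 2 ^ (30 * k) ≤ ∣ X ∣ →
      (∀ v → v ∈ X → ∣ A ∣ ≤ 20 * ∣ inIn T v A ∣) →
      ∣ X ∣ C k ≤ 2 ^ (30 * (k * k)) * #tails T k A X)
lemma2p8 (suc j) _ n T A =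
    head-exists j T A
  , tail-exists
  , heads-count j T A
  , λ X big indegree → subst (λ h → ∣ X ∣ C suc j ≤ 2 ^ (30 * (suc j * suc j)) * h)
                          (#heads-opposite T (suc j) A X) (heads-count j (opposite T) A X big indegree)
  where
  tail-exists : ∀ S → 2 ^ (30 * suc j) ≤ ∣ S ∣ → (∀ v → v ∈ S → ∣ A ∣ ≤ 20 * ∣ inIn T v A ∣) →
                ∃[ H ] (H ⊆ S × IsTail T (suc j) A H)
  tail-exists S big indegree = head→tail (head-exists j (opposite T) A S big indegree)
    where
    head→tail : ∃[ H ] (H ⊆ S × IsHead (opposite T) (suc j) A H) → ∃[ H ] (H ⊆ S × IsTail T (suc j) A H)
    head→tail (H , H⊆S , head) = H , H⊆S , subst Bool.T (isHeadB-opposite T (suc j) A H) head
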